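{- Let $CP_3(n)$ be defined by $\sum_{n\ge 0} CP_3(n)q^n = \dfrac{f_3^6f_6^6}{f_1^2f_2^2}$. Then \[ \sum_{n=0}^\infty CP_3(2n)q^n = \frac{f_2^6f_3^{10}}{f_1^6f_6^2}+q\frac{f_3^6f_6^6}{f_1^2f_2^2},\qquad \sum_{n=0}^\infty CP_3(2n+1)q^n = 2\frac{f_2^2f_3^8f_6^2}{f_1^4}. \]
   Context: For $|q|<1$ and integer $m\ge 1$, $f_m := (q^m;q^m)_\infty=\prod_{n\ge1}(1-q^{mn})$. $CP_3(n)$ is the number of $3$-core cubic bipartitions of $n$, defined by the generating function $\sum_{n\ge0}CP_3(n)q^n = \frac{f_3^6f_6^6}{f_1^2f_2^2}$. Identities are of formal power series in $q$. -}

module Defs where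

open import Data.Nat using (ℕ; zero; suc; _∸_) renaming (_*_ to _*ℕ_; _≡ᵇ_ to _==_)
open import Data.Integer using (ℤ; 0ℤ; 1ℤ; +_; -_) renaming (_+_ to _+ℤ_; _*_ to _*ℤ_)
open import Data.Bool using (if_then_else_)

Series : Set
Series = ℕ → ℤ

sumTo : ℕ → (ℕ → ℤ) → ℤ
sumTo zero    g = g 0
sumTo (suc n) g = sumTo n g +ℤ g (suc n)

sum1To : ℕ → (ℕ → ℤ) → ℤ
sum1To zero    g = 0ℤ
sum1To (suc n) g = sum1To n g +ℤ g (suc n)

infixl 6 _⊕_
infixl 7 _⊛_
infixr 8 _^^_

_⊕_ : Series → Series → Series
(a ⊕ b) n = a n +ℤ b n

_⊛_ : Series → Series → Series
(a ⊛ b) n = sumTo n (λ i → a i *ℤ b (n ∸ i))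

const : ℤ → Series
const c zero    = c
const c (suc n) = 0ℤ

one : Series
one = const 1ℤ

scale : ℤ → Series → Series
scale c a n = c *ℤ a n

qTimes : Series → Series
qTimes a zero    = 0ℤ
qTimes a (suc n) = a n

_^^_ : Series → ℕ → Series
a ^^ zero  = one
a ^^ suc k = a ⊛ (a ^^ k)

-- multiplicative inverse of a series with constant term 1:
-- b 0 = 1, b n = - Σ_{j=1}^{n} a j * b (n - j).
-- invApprox a n agrees with the inverse on coefficients 0..n.
invApprox : Series → ℕ → Series
invApprox a zero    k = const 1ℤ k
invApprox a (suc n) k =
  if k == suc n
  then - sum1To (suc n) (λ j → a j *ℤ invApprox a n (suc n ∸ j))
  else invApprox a n k

inv : Series → Series
inv a n = invApprox a n n

oneMinusQ^ : ℕ → Series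
oneMinusQ^ e k = const 1ℤ k +ℤ (if k == e then - 1ℤ else 0ℤ)

partialProd : ℕ → ℕ → Series
partialProd m zero    = one
partialProd m (suc N) = partialProd m N ⊛ oneMinusQ^ (m *ℕ suc N)

-- f_m = (q^m; q^m)_∞ = ∏_{k≥1} (1 - q^{m k}); for m ≥ 1 the coefficient of q^n
-- is already stable in the partial product up to N = n.
f : ℕ → Series
f m n = partialProd m n n

CP3series : Series
CP3series = f 3 ^^ 6 ⊛ f 6 ^^ 6 ⊛ inv (f 1) ^^ 2 ⊛ inv (f 2) ^^ 2

CP3 : ℕ → ℤ
CP3 = CP3series

module Submission where

-- Writing f_k for (q^k; q^k)_∞, the generating function of CP₃ is (f₃³/f₁)² · f₆⁶/f₂². The 2-dissection
-- f₃³/f₁ = A + q B with A = f₄³f₆²/(f₂²f₁₂) and B = f₁₂³/f₄ turns it into A²Y + 2q ABY + q² B²Y with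
-- Y = f₆⁶/f₂², and each of A²Y, ABY and B²Y is the image under q ↦ q² of an eta quotient of the statement,
-- so the even and odd parts separate. The 2-dissection is Schröter's identity θ₁θ₂ = θ₃² + q θ₄² for four
-- theta series, each of which the Jacobi triple product (proved from its finite form with Gaussian binomials)
-- turns into a product of q-Pochhammer symbols; splitting these by residue classes expresses everything
-- through f₁, f₂, f₃, f₄, f₆ and f₁₂.

open import Defs
open import Data.Nat using (ℕ; zero; suc; _+_; _*_; _∸_; _≤_; _<_; _≡ᵇ_; z≤n; s≤s; NonZero; >-nonZero)
import Data.Nat.Properties as ℕₚ
open import Data.Integer using (ℤ; 0ℤ; 1ℤ; -1ℤ; +_; -_; -[1+_]; ∣_∣; +-*-rawRing) renaming (_+_ to _+ℤ_; _*_ to _*ℤ_; _-_ to _-ℤ_; _^_ to _^ℤ_)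
import Data.Integer.Properties as ℤₚ
open import Data.Bool using (true; false; if_then_else_)
open import Data.Product using (_×_; _,_)
open import Data.Sum using (inj₁; inj₂)
open import Function using (_∘_)
open import Relation.Nullary using (yes; no)
open import Relation.Binary.PropositionalEquality
import Data.Integer.Tactic.RingSolver as ℤ-Solver
import Data.Nat.Tactic.RingSolver as ℕ-Solver

module SeriesRing where

  open import Algebra.Bundles using (CommutativeRing)
  open import Algebra.Structures using (IsCommutativeRing)
  open import Data.Maybe using (Maybe; just; nothing)
  import Algebra.Solver.Ring
  import Algebra.Solver.Ring.AlmostCommutativeRing as ACR
  import Relation.Binary.Structures as RBS
  import Relation.Binary.Reasoning.Setoid as SetoidReasoning

  antidiagonal : ℕ → (ℕ → ℕ → ℤ) → ℤ
  antidiagonal zero    F = F 0 0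
  antidiagonal (suc n) F = F 0 (suc n) +ℤ antidiagonal n (λ i j → F (suc i) j)

  sumTo-uncons : ∀ n (g : ℕ → ℤ) → sumTo (suc n) g ≡ g 0 +ℤ sumTo n (g ∘ suc)
  sumTo-uncons zero    g = refl
  sumTo-uncons (suc n) g = trans (cong (_+ℤ g (suc (suc n))) (sumTo-uncons n g)) (ℤₚ.+-assoc (g 0) _ _)

  sumTo≡antidiagonal : ∀ n F → sumTo n (λ i → F i (n ∸ i)) ≡ antidiagonal n F
  sumTo≡antidiagonal zero    F = refl
  sumTo≡antidiagonal (suc n) F =
    trans (sumTo-uncons n (λ i → F i (suc n ∸ i)))
          (cong (F 0 (suc n) +ℤ_) (sumTo≡antidiagonal n (λ i j → F (suc i) j)))

  ⊛≡antidiagonal : ∀ a b n → (a ⊛ b) n ≡ antidiagonal n (λ i j → a i *ℤ b j)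
  ⊛≡antidiagonal a b n = sumTo≡antidiagonal n (λ i j → a i *ℤ b j)

  antidiagonal-cong-on : ∀ n {F G : ℕ → ℕ → ℤ} → (∀ i j → i + j ≡ n → F i j ≡ G i j) →
                         antidiagonal n F ≡ antidiagonal n G
  antidiagonal-cong-on zero    h = h 0 0 refl
  antidiagonal-cong-on (suc n) h =
    cong₂ _+ℤ_ (h 0 (suc n) refl) (antidiagonal-cong-on n (λ i j e → h (suc i) j (cong suc e)))

  antidiagonal-cong : ∀ n {F G : ℕ → ℕ → ℤ} → (∀ i j → F i j ≡ G i j) → antidiagonal n F ≡ antidiagonal n G
  antidiagonal-cong n h = antidiagonal-cong-on n (λ i j _ → h i j)

  antidiagonal-+ : ∀ n F G → antidiagonal n (λ i j → F i j +ℤ G i j) ≡ antidiagonal n F +ℤ antidiagonal n G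
  antidiagonal-+ zero    F G = refl
  antidiagonal-+ (suc n) F G =
    trans (cong (F 0 (suc n) +ℤ G 0 (suc n) +ℤ_) (antidiagonal-+ n _ _))
          (interchange (F 0 (suc n)) (G 0 (suc n)) _ _)
    where
    interchange : ∀ a b c d → a +ℤ b +ℤ (c +ℤ d) ≡ a +ℤ c +ℤ (b +ℤ d)
    interchange = ℤ-Solver.solve-∀

  antidiagonal-*ˡ : ∀ n c F → antidiagonal n (λ i j → c *ℤ F i j) ≡ c *ℤ antidiagonal n F
  antidiagonal-*ˡ zero    c F = refl
  antidiagonal-*ˡ (suc n) c F =
    trans (cong (c *ℤ F 0 (suc n) +ℤ_) (antidiagonal-*ˡ n c _)) (sym (ℤₚ.*-distribˡ-+ c _ _))

  antidiagonal-*ʳ : ∀ n c F → antidiagonal n (λ i j → F i j *ℤ c) ≡ antidiagonal n F *ℤ c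
  antidiagonal-*ʳ n c F =
    trans (antidiagonal-cong n (λ i j → ℤₚ.*-comm (F i j) c))
          (trans (antidiagonal-*ˡ n c F) (ℤₚ.*-comm c _))

  antidiagonal-zero : ∀ n → antidiagonal n (λ _ _ → 0ℤ) ≡ 0ℤ
  antidiagonal-zero zero    = refl
  antidiagonal-zero (suc n) = trans (ℤₚ.+-identityˡ _) (antidiagonal-zero n)

  antidiagonal-unsnoc : ∀ n F → antidiagonal (suc n) F ≡ antidiagonal n (λ i j → F i (suc j)) +ℤ F (suc n) 0
  antidiagonal-unsnoc zero    F = refl
  antidiagonal-unsnoc (suc n) F =
    trans (cong (F 0 (suc (suc n)) +ℤ_) (antidiagonal-unsnoc n (λ i j → F (suc i) j)))
          (sym (ℤₚ.+-assoc (F 0 (suc (suc n))) _ _))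

  antidiagonal-swap : ∀ n F → antidiagonal n F ≡ antidiagonal n (λ i j → F j i)
  antidiagonal-swap zero    F = refl
  antidiagonal-swap (suc n) F =
    trans (cong (F 0 (suc n) +ℤ_) (antidiagonal-swap n (λ i j → F (suc i) j)))
          (trans (ℤₚ.+-comm (F 0 (suc n)) _) (sym (antidiagonal-unsnoc n (λ i j → F j i))))

  antidiagonal-assoc : ∀ n (F : ℕ → ℕ → ℕ → ℤ) →
    antidiagonal n (λ i j → antidiagonal i (λ k l → F k l j)) ≡ antidiagonal n (λ k r → antidiagonal r (λ l j → F k l j))
  antidiagonal-assoc zero    F = refl
  antidiagonal-assoc (suc n) F =
    trans (cong (F 0 0 (suc n) +ℤ_)
            (trans (antidiagonal-+ n (λ i j → F 0 (suc i) j) (λ i j → antidiagonal i (λ k l → F (suc k) l j)))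
                   (cong (antidiagonal n (λ i j → F 0 (suc i) j) +ℤ_) (antidiagonal-assoc n (λ k l j → F (suc k) l j)))))
          (sym (ℤₚ.+-assoc (F 0 0 (suc n)) _ _))

  infix 4 _≈_
  _≈_ : Series → Series → Set
  a ≈ b = ∀ n → a n ≡ b n

  ≈-refl : ∀ {a} → a ≈ a
  ≈-refl n = refl

  ≈-sym : ∀ {a b} → a ≈ b → b ≈ a
  ≈-sym p n = sym (p n)

  ≈-trans : ∀ {a b c} → a ≈ b → b ≈ c → a ≈ c
  ≈-trans p q n = trans (p n) (q n)

  neg : Series → Series
  neg a n = - a n

  0ₛ : Series
  0ₛ _ = 0ℤ

  neg-cong : ∀ {a a′} → a ≈ a′ → neg a ≈ neg a′
  neg-cong p n = cong -_ (p n)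

  ⊕-cong : ∀ {a a′ b b′} → a ≈ a′ → b ≈ b′ → a ⊕ b ≈ a′ ⊕ b′
  ⊕-cong p q n = cong₂ _+ℤ_ (p n) (q n)

  ⊛-cong : ∀ {a a′ b b′} → a ≈ a′ → b ≈ b′ → a ⊛ b ≈ a′ ⊛ b′
  ⊛-cong {a} {a′} {b} {b′} p q n =
    trans (⊛≡antidiagonal a b n)
          (trans (antidiagonal-cong n (λ i j → cong₂ _*ℤ_ (p i) (q j))) (sym (⊛≡antidiagonal a′ b′ n)))

  ⊛-comm : ∀ a b → a ⊛ b ≈ b ⊛ a
  ⊛-comm a b n =
    trans (⊛≡antidiagonal a b n)
          (trans (antidiagonal-swap n _)
                 (trans (antidiagonal-cong n (λ i j → ℤₚ.*-comm (a j) (b i))) (sym (⊛≡antidiagonal b a n))))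

  ⊛-assoc : ∀ a b c → (a ⊛ b) ⊛ c ≈ a ⊛ (b ⊛ c)
  ⊛-assoc a b c n = begin
    ((a ⊛ b) ⊛ c) n
      ≡⟨ ⊛≡antidiagonal (a ⊛ b) c n ⟩
    antidiagonal n (λ i j → (a ⊛ b) i *ℤ c j)
      ≡⟨ antidiagonal-cong n (λ i j → trans (cong (_*ℤ c j) (⊛≡antidiagonal a b i)) (sym (antidiagonal-*ʳ i (c j) _))) ⟩
    antidiagonal n (λ i j → antidiagonal i (λ k l → a k *ℤ b l *ℤ c j))
      ≡⟨ antidiagonal-assoc n (λ k l j → a k *ℤ b l *ℤ c j) ⟩
    antidiagonal n (λ k r → antidiagonal r (λ l j → a k *ℤ b l *ℤ c j))
      ≡⟨ antidiagonal-cong n (λ k r → trans (antidiagonal-cong r (λ l j → ℤₚ.*-assoc (a k) (b l) (c j)))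
                                        (trans (antidiagonal-*ˡ r (a k) _) (cong (a k *ℤ_) (sym (⊛≡antidiagonal b c r))))) ⟩
    antidiagonal n (λ i j → a i *ℤ (b ⊛ c) j)
      ≡⟨ sym (⊛≡antidiagonal a (b ⊛ c) n) ⟩
    (a ⊛ (b ⊛ c)) n ∎
    where open ≡-Reasoning

  ⊛-distribˡ : ∀ a b c → a ⊛ (b ⊕ c) ≈ (a ⊛ b) ⊕ (a ⊛ c)
  ⊛-distribˡ a b c n =
    trans (⊛≡antidiagonal a (b ⊕ c) n)
          (trans (antidiagonal-cong n (λ i j → ℤₚ.*-distribˡ-+ (a i) (b j) (c j)))
                 (trans (antidiagonal-+ n _ _) (sym (cong₂ _+ℤ_ (⊛≡antidiagonal a b n) (⊛≡antidiagonal a c n)))))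

  ⊛-distribʳ : ∀ a b c → (b ⊕ c) ⊛ a ≈ (b ⊛ a) ⊕ (c ⊛ a)
  ⊛-distribʳ a b c n =
    trans (⊛-comm (b ⊕ c) a n) (trans (⊛-distribˡ a b c n) (cong₂ _+ℤ_ (⊛-comm a b n) (⊛-comm a c n)))

  ⊛-zeroʳ : ∀ a → a ⊛ 0ₛ ≈ 0ₛ
  ⊛-zeroʳ a n = trans (⊛≡antidiagonal a 0ₛ n) (trans (antidiagonal-cong n (λ i j → ℤₚ.*-zeroʳ (a i))) (antidiagonal-zero n))

  const-⊛ : ∀ c a → const c ⊛ a ≈ scale c a
  const-⊛ c a n = trans (⊛≡antidiagonal (const c) a n) (const-antidiagonal n)
    where
    const-antidiagonal : ∀ n → antidiagonal n (λ i j → const c i *ℤ a j) ≡ c *ℤ a n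
    const-antidiagonal zero    = refl
    const-antidiagonal (suc n) = trans (cong (c *ℤ a (suc n) +ℤ_)
                         (trans (antidiagonal-cong n (λ i j → ℤₚ.*-zeroˡ (a j))) (antidiagonal-zero n)))
                       (ℤₚ.+-identityʳ _)

  ⊛-identityˡ : ∀ a → one ⊛ a ≈ a
  ⊛-identityˡ a n = trans (const-⊛ 1ℤ a n) (ℤₚ.*-identityˡ (a n))

  ⊛-identityʳ : ∀ a → a ⊛ one ≈ a
  ⊛-identityʳ a n = trans (⊛-comm a one n) (⊛-identityˡ a n)

  ⊕-⊛-isCommutativeRing : IsCommutativeRing _≈_ _⊕_ _⊛_ neg 0ₛ one
  ⊕-⊛-isCommutativeRing = record
    { isRing = record
      { +-isAbelianGroup = record
        { isGroup = record
          { isMonoid = record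
            { isSemigroup = record
              { isMagma = record { isEquivalence = ≈-isEquivalence ; ∙-cong = ⊕-cong }
              ; assoc = λ a b c n → ℤₚ.+-assoc (a n) (b n) (c n) }
            ; identity = (λ a n → ℤₚ.+-identityˡ (a n)) , (λ a n → ℤₚ.+-identityʳ (a n)) }
          ; inverse = (λ a n → ℤₚ.+-inverseˡ (a n)) , (λ a n → ℤₚ.+-inverseʳ (a n))
          ; ⁻¹-cong = neg-cong }
        ; comm = λ a b n → ℤₚ.+-comm (a n) (b n) }
      ; *-cong = ⊛-cong
      ; *-assoc = ⊛-assoc
      ; *-identity = ⊛-identityˡ , ⊛-identityʳ
      ; distrib = ⊛-distribˡ , ⊛-distribʳ }
    ; *-comm = ⊛-comm }
    where
    ≈-isEquivalence : RBS.IsEquivalence _≈_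
    ≈-isEquivalence = record { refl = ≈-refl ; sym = ≈-sym ; trans = ≈-trans }

  ⊕-⊛-commutativeRing : CommutativeRing _ _
  ⊕-⊛-commutativeRing = record { isCommutativeRing = ⊕-⊛-isCommutativeRing }

  const-+ : ∀ a b → const (a +ℤ b) ≈ const a ⊕ const b
  const-+ a b zero    = refl
  const-+ a b (suc n) = refl

  const-* : ∀ a b → const (a *ℤ b) ≈ const a ⊛ const b
  const-* a b n = sym (trans (const-⊛ a (const b) n) (scale-const n))
    where
    scale-const : ∀ n → a *ℤ const b n ≡ const (a *ℤ b) n
    scale-const zero    = refl
    scale-const (suc n) = ℤₚ.*-zeroʳ a

  ⊕-⊛-almostCommutativeRing : ACR.AlmostCommutativeRing _ _
  ⊕-⊛-almostCommutativeRing = ACR.fromCommutativeRing ⊕-⊛-commutativeRing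

  const-morphism : +-*-rawRing ACR.-Raw-AlmostCommutative⟶ ⊕-⊛-almostCommutativeRing
  const-morphism = record
    { ⟦_⟧    = const
    ; +-homo = const-+
    ; *-homo = const-*
    ; -‿homo = λ { a zero → refl ; a (suc n) → refl }
    ; 0-homo = λ { zero → refl ; (suc n) → refl }
    ; 1-homo = λ n → refl }

  const-≟ : ∀ a b → Maybe (const a ≈ const b)
  const-≟ a b with a ℤₚ.≟ b
  ... | yes refl = just ≈-refl
  ... | no _     = nothing

  module Series-Solver =
    Algebra.Solver.Ring +-*-rawRing ⊕-⊛-almostCommutativeRing const-morphism const-≟

  module ≈-Reasoning = SetoidReasoning (CommutativeRing.setoid ⊕-⊛-commutativeRing)

open SeriesRing

module MonomialsAndInverses where

  open Series-Solver using (solve; _:=_; _:*_)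

  qTimes-cong : ∀ {a b} → a ≈ b → qTimes a ≈ qTimes b
  qTimes-cong p zero    = refl
  qTimes-cong p (suc n) = p n

  qTimes-⊛ : ∀ a b → qTimes a ⊛ b ≈ qTimes (a ⊛ b)
  qTimes-⊛ a b zero    = trans (⊛≡antidiagonal (qTimes a) b 0) (ℤₚ.*-zeroˡ (b 0))
  qTimes-⊛ a b (suc n) =
    trans (⊛≡antidiagonal (qTimes a) b (suc n))
          (trans (cong (_+ℤ antidiagonal n (λ i j → a i *ℤ b j)) (ℤₚ.*-zeroˡ (b (suc n))))
                 (trans (ℤₚ.+-identityˡ _) (sym (⊛≡antidiagonal a b n))))

  q : Series
  q = qTimes one

  qTimes≈q⊛ : ∀ a → qTimes a ≈ q ⊛ a
  qTimes≈q⊛ a = ≈-trans (qTimes-cong (≈-sym (⊛-identityˡ a))) (≈-sym (qTimes-⊛ one a))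

  monomial : ℕ → Series
  monomial e k = if k ≡ᵇ e then 1ℤ else 0ℤ

  monomial-zero : monomial 0 ≈ one
  monomial-zero zero    = refl
  monomial-zero (suc k) = refl

  monomial-suc : ∀ e → monomial (suc e) ≈ qTimes (monomial e)
  monomial-suc e zero    = refl
  monomial-suc e (suc k) = refl

  monomial-⊛-monomial : ∀ d e → monomial d ⊛ monomial e ≈ monomial (d + e)
  monomial-⊛-monomial zero    e = ≈-trans (⊛-cong monomial-zero (≈-refl {monomial e})) (⊛-identityˡ (monomial e))
  monomial-⊛-monomial (suc d) e =
    ≈-trans (⊛-cong (monomial-suc d) (≈-refl {monomial e}))
            (≈-trans (qTimes-⊛ (monomial d) (monomial e))
                     (≈-trans (qTimes-cong (monomial-⊛-monomial d e)) (≈-sym (monomial-suc (d + e)))))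

  monomial-cong : ∀ {d e} → d ≡ e → monomial d ≈ monomial e
  monomial-cong refl = ≈-refl

  ≡ᵇ-refl : ∀ n → (n ≡ᵇ n) ≡ true
  ≡ᵇ-refl zero    = refl
  ≡ᵇ-refl (suc n) = ≡ᵇ-refl n

  <⇒≡ᵇ-false : ∀ {k n} → k < n → (k ≡ᵇ n) ≡ false
  <⇒≡ᵇ-false {zero}  {suc n} _         = refl
  <⇒≡ᵇ-false {suc k} {suc n} (s≤s k<n) = <⇒≡ᵇ-false k<n

  monomial-below : ∀ {k e} → k < e → monomial e k ≡ 0ℤ
  monomial-below {k} {e} k<e rewrite <⇒≡ᵇ-false k<e = refl

  oneMinusQ^≈ : ∀ e → oneMinusQ^ e ≈ one ⊕ neg (monomial e)
  oneMinusQ^≈ e k with k ≡ᵇ e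
  ... | true  = refl
  ... | false = refl

  scale-identityˡ : ∀ a → scale 1ℤ a ≈ a
  scale-identityˡ a n = ℤₚ.*-identityˡ (a n)

  ⊛-interchange : ∀ a b c d → (a ⊛ b) ⊛ (c ⊛ d) ≈ (a ⊛ c) ⊛ (b ⊛ d)
  ⊛-interchange = solve 4 (λ a b c d → (a :* b) :* (c :* d) := (a :* c) :* (b :* d)) ≈-refl

  scale-monomial-⊛ : ∀ c c′ d e → scale c (monomial d) ⊛ scale c′ (monomial e) ≈ scale (c *ℤ c′) (monomial (d + e))
  scale-monomial-⊛ c c′ d e =
    ≈-trans (⊛-cong (≈-sym (const-⊛ c (monomial d))) (≈-sym (const-⊛ c′ (monomial e))))
    (≈-trans (⊛-interchange (const c) (monomial d) (const c′) (monomial e))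
    (≈-trans (⊛-cong (≈-sym (const-* c c′)) (monomial-⊛-monomial d e)) (const-⊛ (c *ℤ c′) (monomial (d + e)))))

  monomial-⊛-scale : ∀ d c e → monomial d ⊛ scale c (monomial e) ≈ scale c (monomial (d + e))
  monomial-⊛-scale d c e =
    ≈-trans (⊛-cong (≈-sym (scale-identityˡ (monomial d))) (≈-refl {scale c (monomial e)}))
    (≈-trans (scale-monomial-⊛ 1ℤ c d e) (λ n → cong (_*ℤ monomial (d + e) n) (ℤₚ.*-identityˡ c)))

  ^^-cong : ∀ {a b} n → a ≈ b → a ^^ n ≈ b ^^ n
  ^^-cong zero    p = ≈-refl
  ^^-cong (suc n) p = ⊛-cong p (^^-cong n p)

  ^^-+ : ∀ a i j → a ^^ (i + j) ≈ a ^^ i ⊛ a ^^ j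
  ^^-+ a zero    j = ≈-sym (⊛-identityˡ (a ^^ j))
  ^^-+ a (suc i) j = ≈-trans (⊛-cong (≈-refl {a}) (^^-+ a i j)) (≈-sym (⊛-assoc a (a ^^ i) (a ^^ j)))

  ^^-* : ∀ a i j → a ^^ (j * i) ≈ (a ^^ i) ^^ j
  ^^-* a i zero    = ≈-refl
  ^^-* a i (suc j) = ≈-trans (^^-+ a i (j * i)) (⊛-cong (≈-refl {a ^^ i}) (^^-* a i j))

  infix 4 _≈[_]_
  _≈[_]_ : Series → ℕ → Series → Set
  a ≈[ N ] b = ∀ k → k ≤ N → a k ≡ b k

  ≈⇒≈[] : ∀ {a b} N → a ≈ b → a ≈[ N ] b
  ≈⇒≈[] N p k _ = p k

  ≈[]-refl : ∀ {a N} → a ≈[ N ] a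
  ≈[]-refl _ _ = refl

  ≈[]-sym : ∀ {a b N} → a ≈[ N ] b → b ≈[ N ] a
  ≈[]-sym p k h = sym (p k h)

  ≈[]-trans : ∀ {a b c N} → a ≈[ N ] b → b ≈[ N ] c → a ≈[ N ] c
  ≈[]-trans p q k h = trans (p k h) (q k h)

  ≈[]-weaken : ∀ {a b N M} → M ≤ N → a ≈[ N ] b → a ≈[ M ] b
  ≈[]-weaken M≤N p k h = p k (ℕₚ.≤-trans h M≤N)

  ⊛-cong[] : ∀ {a a′ b b′ N} → a ≈[ N ] a′ → b ≈[ N ] b′ → a ⊛ b ≈[ N ] a′ ⊛ b′
  ⊛-cong[] {a} {a′} {b} {b′} p q k k≤N =
    trans (⊛≡antidiagonal a b k)
          (trans (antidiagonal-cong-on k (λ i j e →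
                    cong₂ _*ℤ_ (p i (ℕₚ.≤-trans (ℕₚ.m≤m+n i j) (subst (_≤ _) (sym e) k≤N)))
                               (q j (ℕₚ.≤-trans (ℕₚ.m≤n+m j i) (subst (_≤ _) (sym e) k≤N)))))
                 (sym (⊛≡antidiagonal a′ b′ k)))

  sumTo≡head+sum1To : ∀ n (g : ℕ → ℤ) → sumTo n g ≡ g 0 +ℤ sum1To n g
  sumTo≡head+sum1To zero    g = sym (ℤₚ.+-identityʳ _)
  sumTo≡head+sum1To (suc n) g = trans (cong (_+ℤ g (suc n)) (sumTo≡head+sum1To n g)) (ℤₚ.+-assoc (g 0) _ _)

  sum1To-cong : ∀ n {g h : ℕ → ℤ} → (∀ j → 1 ≤ j → j ≤ n → g j ≡ h j) → sum1To n g ≡ sum1To n h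
  sum1To-cong zero    p = refl
  sum1To-cong (suc n) p =
    cong₂ _+ℤ_ (sum1To-cong n (λ j 1≤j j≤n → p j 1≤j (ℕₚ.m≤n⇒m≤1+n j≤n))) (p (suc n) (s≤s z≤n) ℕₚ.≤-refl)

  invApprox-stable : ∀ a n k → k ≤ n → invApprox a n k ≡ inv a k
  invApprox-stable a zero    zero h = refl
  invApprox-stable a (suc n) k  h with ℕₚ.m≤n⇒m<n∨m≡n h
  ... | inj₂ refl = refl
  ... | inj₁ k<1+n rewrite <⇒≡ᵇ-false k<1+n = invApprox-stable a n k (ℕₚ.≤-pred k<1+n)

  inv-suc : ∀ a n → inv a (suc n) ≡ - sum1To (suc n) (λ j → a j *ℤ inv a (suc n ∸ j))
  inv-suc a n rewrite ≡ᵇ-refl n =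
    cong -_ (sum1To-cong (suc n) (λ { (suc j) _ _ → cong (a (suc j) *ℤ_) (invApprox-stable a n _ (ℕₚ.m∸n≤m n j)) }))

  ⊛-inverseʳ : ∀ a → a 0 ≡ 1ℤ → a ⊛ inv a ≈ one
  ⊛-inverseʳ a a₀≡1 zero rewrite a₀≡1 = refl
  ⊛-inverseʳ a a₀≡1 (suc n) =
    trans (sumTo≡head+sum1To (suc n) _)
          (trans (cong (_+ℤ sum1To (suc n) (λ j → a j *ℤ inv a (suc n ∸ j))) (trans (cong (_*ℤ inv a (suc n)) a₀≡1) (trans (ℤₚ.*-identityˡ _) (inv-suc a n))))
                 (ℤₚ.+-inverseˡ (sum1To (suc n) (λ j → a j *ℤ inv a (suc n ∸ j)))))

  inverse-unique : ∀ a x y → a ⊛ x ≈ one → a ⊛ y ≈ one → x ≈ y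
  inverse-unique a x y ax≈1 ay≈1 =
    ≈-trans (≈-sym (⊛-identityʳ x))
    (≈-trans (⊛-cong (≈-refl {x}) (≈-sym ay≈1))
    (≈-trans (solve 3 (λ x a y → x :* (a :* y) := (a :* x) :* y) ≈-refl x a y)
    (≈-trans (⊛-cong ax≈1 (≈-refl {y})) (⊛-identityˡ y))))

open MonomialsAndInverses

module InfiniteProducts where

  open Series-Solver using (solve; _:=_; _:+_; _:*_; con)

  prod : (ℕ → Series) → ℕ → Series
  prod g zero    = one
  prod g (suc K) = prod g K ⊛ g K

  -- Only the n-th partial product is consulted for the coefficient of q^n, so ∏ g is the infinite product
  -- exactly when FactorsTendToOne g.
  ∏ : (ℕ → Series) → Series
  ∏ g n = prod g n n

  FactorsTendToOne : (ℕ → Series) → Set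
  FactorsTendToOne g = ∀ k → g k ≈[ k ] one

  ≈[]one-⊛ : ∀ {a b N} → a ≈[ N ] one → b ≈[ N ] one → a ⊛ b ≈[ N ] one
  ≈[]one-⊛ p q = ≈[]-trans (⊛-cong[] p q) (≈⇒≈[] _ (⊛-identityˡ one))

  prod-tendsToOne : ∀ {g} → FactorsTendToOne g → ∀ N d → prod g (d + N) ≈[ N ] prod g N
  prod-tendsToOne tg N zero    = ≈[]-refl
  prod-tendsToOne tg N (suc d) =
    ≈[]-trans (⊛-cong[] (prod-tendsToOne tg N d) (≈[]-weaken (ℕₚ.m≤n+m N d) (tg (d + N))))
              (≈⇒≈[] N (⊛-identityʳ _))

  ∏≈[]prod : ∀ {g} → FactorsTendToOne g → ∀ N K → N ≤ K → ∏ g ≈[ N ] prod g K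
  ∏≈[]prod {g} tg N K N≤K k k≤N =
    sym (subst (λ x → prod g x k ≡ prod g k k) (ℕₚ.m∸n+n≡m (ℕₚ.≤-trans k≤N N≤K))
               (prod-tendsToOne tg k (K ∸ k) k ℕₚ.≤-refl))

  prod-cong : ∀ {g h} → (∀ k → g k ≈ h k) → ∀ K → prod g K ≈ prod h K
  prod-cong p zero    = ≈-refl
  prod-cong p (suc K) = ⊛-cong (prod-cong p K) (p K)

  ∏-cong : ∀ {g h} → (∀ k → g k ≈ h k) → ∏ g ≈ ∏ h
  ∏-cong p n = prod-cong p n n

  prod-⊛ : ∀ g h K → prod (λ k → g k ⊛ h k) K ≈ prod g K ⊛ prod h K
  prod-⊛ g h zero    = ≈-sym (⊛-identityˡ one)
  prod-⊛ g h (suc K) =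
    ≈-trans (⊛-cong (prod-⊛ g h K) (≈-refl {g K ⊛ h K})) (⊛-interchange (prod g K) (prod h K) (g K) (h K))

  ∏-⊛ : ∀ {g h} → FactorsTendToOne g → FactorsTendToOne h → ∏ (λ k → g k ⊛ h k) ≈ ∏ g ⊛ ∏ h
  ∏-⊛ {g} {h} tg th n =
    trans (prod-⊛ g h n n) (sym (⊛-cong[] (∏≈[]prod tg n n ℕₚ.≤-refl) (∏≈[]prod th n n ℕₚ.≤-refl) n ℕₚ.≤-refl))

  prod-tendsToOne-pointwise : ∀ (h : ℕ → ℕ → Series) → (∀ r → FactorsTendToOne (h r)) →
                              ∀ d → FactorsTendToOne (λ k → prod (λ r → h r k) d)
  prod-tendsToOne-pointwise h th zero    k = ≈[]-refl
  prod-tendsToOne-pointwise h th (suc d) k = ≈[]one-⊛ (prod-tendsToOne-pointwise h th d k) (th d k)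

  ∏-one : ∏ (λ _ → one) ≈ one
  ∏-one n = prod-one n n
    where
    prod-one : ∀ K → prod (λ _ → one) K ≈ one
    prod-one zero    = ≈-refl
    prod-one (suc K) = ≈-trans (⊛-cong (prod-one K) (≈-refl {one})) (⊛-identityˡ one)

  ∏-prod : ∀ (h : ℕ → ℕ → Series) → (∀ r → FactorsTendToOne (h r)) →
           ∀ d → ∏ (λ k → prod (λ r → h r k) d) ≈ prod (λ r → ∏ (h r)) d
  ∏-prod h th zero    = ∏-one
  ∏-prod h th (suc d) =
    ≈-trans (∏-⊛ (prod-tendsToOne-pointwise h th d) (th d)) (⊛-cong (∏-prod h th d) (≈-refl {∏ (h d)}))

  prod-+ : ∀ g M d → prod g (M + d) ≈ prod g M ⊛ prod (λ r → g (M + r)) d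
  prod-+ g M zero    rewrite ℕₚ.+-identityʳ M = ≈-sym (⊛-identityʳ _)
  prod-+ g M (suc d) rewrite ℕₚ.+-suc M d =
    ≈-trans (⊛-cong (prod-+ g M d) (≈-refl {g (M + d)}))
            (⊛-assoc (prod g M) (prod (λ r → g (M + r)) d) (g (M + d)))

  prod-block : ∀ g d K → prod (λ k → prod (λ r → g (d * k + r)) d) K ≈ prod g (d * K)
  prod-block g d zero    rewrite ℕₚ.*-zeroʳ d = ≈-refl
  prod-block g d (suc K) =
    ≈-trans (⊛-cong (prod-block g d K) (≈-refl {prod (λ r → g (d * K + r)) d}))
    (≈-trans (≈-sym (prod-+ g (d * K) d))
             (λ n → cong (λ x → prod g x n) (trans (ℕₚ.+-comm (d * K) d) (sym (ℕₚ.*-suc d K)))))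

  ∏-block : ∀ {g} d → 1 ≤ d → FactorsTendToOne g → ∏ (λ k → prod (λ r → g (d * k + r)) d) ≈ ∏ g
  ∏-block {g} d 1≤d tg n =
    trans (prod-block g d n n) (sym (∏≈[]prod tg n (d * n) n≤d*n n ℕₚ.≤-refl))
    where
    instance _ : NonZero d
             _ = >-nonZero 1≤d
    n≤d*n : n ≤ d * n
    n≤d*n = ℕₚ.≤-trans (ℕₚ.m≤m*n n d) (ℕₚ.≤-reflexive (ℕₚ.*-comm n d))

  -- qPoch -1ℤ e m is (q^e; q^m)_∞ and qPoch 1ℤ e m is (-q^e; q^m)_∞.
  qFactor : ℤ → ℕ → ℕ → ℕ → Series
  qFactor s e m k = one ⊕ scale s (monomial (e + m * k))

  qPoch : ℤ → ℕ → ℕ → Series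
  qPoch s e m = ∏ (qFactor s e m)

  qFactor-tendsToOne : ∀ s e m → 1 ≤ e → 1 ≤ m → FactorsTendToOne (qFactor s e m)
  qFactor-tendsToOne s e m 1≤e 1≤m k j j≤k =
    trans (cong (λ x → one j +ℤ s *ℤ x) (monomial-below j<e+m*k)) (trans (cong (one j +ℤ_) (ℤₚ.*-zeroʳ s)) (ℤₚ.+-identityʳ _))
    where
    instance _ : NonZero m
             _ = >-nonZero 1≤m
    j<e+m*k : j < e + m * k
    j<e+m*k = ℕₚ.≤-trans (s≤s j≤k) (ℕₚ.+-mono-≤ 1≤e (ℕₚ.≤-trans (ℕₚ.m≤m*n k m) (ℕₚ.≤-reflexive (ℕₚ.*-comm k m))))

  qFactor-cong : ∀ s e m k e′ m′ k′ → e + m * k ≡ e′ + m′ * k′ → qFactor s e m k ≈ qFactor s e′ m′ k′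
  qFactor-cong s e m k e′ m′ k′ p n rewrite p = refl

  f≈qPoch : ∀ m → f m ≈ qPoch -1ℤ m m
  f≈qPoch m n = partialProd≈prod n n
    where
    partialProd≈prod : ∀ N → partialProd m N ≈ prod (qFactor -1ℤ m m) N
    partialProd≈prod zero    = ≈-refl
    partialProd≈prod (suc N) =
      ⊛-cong (partialProd≈prod N)
             (≈-trans (oneMinusQ^≈ (m * suc N))
                      (λ n → cong (one n +ℤ_) (trans (sym (ℤₚ.-1*i≡-i _)) (cong (λ x → -1ℤ *ℤ monomial x n) (ℕₚ.*-suc m N)))))

  qPoch-split : ∀ d s e m → 1 ≤ d → 1 ≤ e → 1 ≤ m →
                qPoch s e m ≈ prod (λ r → qPoch s (e + r * m) (d * m)) d
  qPoch-split d s e m 1≤d 1≤e 1≤m =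
    ≈-trans (≈-sym (∏-block d 1≤d (qFactor-tendsToOne s e m 1≤e 1≤m)))
    (≈-trans (∏-cong (λ k → prod-cong (λ r → qFactor-cong s e m (d * k + r) (e + r * m) (d * m) k (regroup e m d k r)) d))
             (∏-prod (λ r → qFactor s (e + r * m) (d * m))
                     (λ r → qFactor-tendsToOne s (e + r * m) (d * m) (ℕₚ.≤-trans 1≤e (ℕₚ.m≤m+n e _)) (ℕₚ.*-mono-≤ 1≤d 1≤m)) d))
    where
    regroup : ∀ e m d k r → e + m * (d * k + r) ≡ e + r * m + d * m * k
    regroup = ℕ-Solver.solve-∀

  qFactor-plus-minus : ∀ e m k → qFactor 1ℤ e m k ⊛ qFactor -1ℤ e m k ≈ qFactor -1ℤ (2 * e) (2 * m) k
  qFactor-plus-minus e m k =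
    ≈-trans (⊛-cong (⊕-cong (≈-refl {one}) (≈-sym (const-⊛ 1ℤ x))) (⊕-cong (≈-refl {one}) (≈-sym (const-⊛ -1ℤ x))))
    (≈-trans (solve 1 (λ x → (con 1ℤ :+ con 1ℤ :* x) :* (con 1ℤ :+ con -1ℤ :* x) := con 1ℤ :+ con -1ℤ :* (x :* x)) ≈-refl x)
    (⊕-cong (≈-refl {one}) (≈-trans (⊛-cong (≈-refl {const -1ℤ}) (≈-trans (monomial-⊛-monomial E E) (monomial-cong (double e m k))))
                                   (const-⊛ -1ℤ _))))
    where
    E : ℕ
    E = e + m * k
    x : Series
    x = monomial E
    double : ∀ e m k → (e + m * k) + (e + m * k) ≡ 2 * e + 2 * m * k
    double = ℕ-Solver.solve-∀

  qPoch-plus-minus : ∀ e m → 1 ≤ e → 1 ≤ m → qPoch 1ℤ e m ⊛ qPoch -1ℤ e m ≈ qPoch -1ℤ (2 * e) (2 * m)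
  qPoch-plus-minus e m 1≤e 1≤m =
    ≈-trans (≈-sym (∏-⊛ (qFactor-tendsToOne 1ℤ e m 1≤e 1≤m) (qFactor-tendsToOne -1ℤ e m 1≤e 1≤m)))
            (∏-cong (qFactor-plus-minus e m))

open InfiniteProducts

module Dilation where

  -- 2 * n rewritten so that dilate below can recurse on it structurally.
  twice : ℕ → ℕ
  twice zero    = zero
  twice (suc n) = suc (suc (twice n))

  twice≡2* : ∀ n → twice n ≡ 2 * n
  twice≡2* zero    = refl
  twice≡2* (suc n) = sym (trans (ℕₚ.*-suc 2 n) (cong (suc ∘ suc) (sym (twice≡2* n))))

  twice-+-* : ∀ e m k → twice (e + m * k) ≡ twice e + twice m * k
  twice-+-* e m k =
    trans (twice≡2* _)
    (trans (ℕₚ.*-distribˡ-+ 2 e (m * k))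
           (cong₂ _+_ (sym (twice≡2* e)) (trans (sym (ℕₚ.*-assoc 2 m k)) (cong (_* k) (sym (twice≡2* m))))))

  -- dilate a is a(q²).
  dilate : Series → Series
  dilate a zero          = a 0
  dilate a (suc zero)    = 0ℤ
  dilate a (suc (suc n)) = dilate (a ∘ suc) n

  dilate-twice : ∀ a n → dilate a (twice n) ≡ a n
  dilate-twice a zero    = refl
  dilate-twice a (suc n) = dilate-twice (a ∘ suc) n

  dilate-suc-twice : ∀ a n → dilate a (suc (twice n)) ≡ 0ℤ
  dilate-suc-twice a zero    = refl
  dilate-suc-twice a (suc n) = dilate-suc-twice (a ∘ suc) n

  dilate-cong[] : ∀ {a b N} → a ≈[ N ] b → dilate a ≈[ N ] dilate b
  dilate-cong[] p k k≤N = agree-up-to k (λ i i≤k → p i (ℕₚ.≤-trans i≤k k≤N))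
    where
    agree-up-to : ∀ {a b} k → (∀ i → i ≤ k → a i ≡ b i) → dilate a k ≡ dilate b k
    agree-up-to zero          p = p 0 z≤n
    agree-up-to (suc zero)    p = refl
    agree-up-to (suc (suc k)) p = agree-up-to k (λ i i≤k → p (suc i) (s≤s (ℕₚ.m≤n⇒m≤1+n i≤k)))

  dilate-cong : ∀ {a b} → a ≈ b → dilate a ≈ dilate b
  dilate-cong p k = dilate-cong[] (≈⇒≈[] k p) k ℕₚ.≤-refl

  dilate-⊕ : ∀ a b → dilate (a ⊕ b) ≈ dilate a ⊕ dilate b
  dilate-⊕ a b zero          = refl
  dilate-⊕ a b (suc zero)    = refl
  dilate-⊕ a b (suc (suc n)) = dilate-⊕ (a ∘ suc) (b ∘ suc) n

  dilate-scale : ∀ c a → dilate (scale c a) ≈ scale c (dilate a)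
  dilate-scale c a zero          = refl
  dilate-scale c a (suc zero)    = sym (ℤₚ.*-zeroʳ c)
  dilate-scale c a (suc (suc n)) = dilate-scale c (a ∘ suc) n

  dilate-one : dilate one ≈ one
  dilate-one zero          = refl
  dilate-one (suc zero)    = refl
  dilate-one (suc (suc n)) = dilate-zero n
    where
    dilate-zero : dilate 0ₛ ≈ 0ₛ
    dilate-zero zero          = refl
    dilate-zero (suc zero)    = refl
    dilate-zero (suc (suc n)) = dilate-zero n

  dilate-qTimes : ∀ a → dilate (qTimes a) ≈ qTimes (qTimes (dilate a))
  dilate-qTimes a zero          = refl
  dilate-qTimes a (suc zero)    = refl
  dilate-qTimes a (suc (suc n)) = refl

  dilate-⊛ : ∀ a b → dilate (a ⊛ b) ≈ dilate a ⊛ dilate b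
  dilate-⊛ a b N =
    sym (trans (⊛≡antidiagonal (dilate a) (dilate b) N)
               (trans (antidiagonal-dilate N a) (dilate-cong (λ n → sym (⊛≡antidiagonal a b n)) N)))
    where
    antidiagonal-dilate : ∀ N a → antidiagonal N (λ i j → dilate a i *ℤ dilate b j) ≡ dilate (λ n → antidiagonal n (λ i j → a i *ℤ b j)) N
    antidiagonal-dilate zero          a = refl
    antidiagonal-dilate (suc zero)    a = cong₂ _+ℤ_ (ℤₚ.*-zeroʳ (a 0)) (ℤₚ.*-zeroˡ (b 0))
    antidiagonal-dilate (suc (suc N)) a =
      trans (cong (a 0 *ℤ dilate b (suc (suc N)) +ℤ_)
                  (trans (cong₂ _+ℤ_ (ℤₚ.*-zeroˡ (dilate b (suc N))) (antidiagonal-dilate N (a ∘ suc))) (ℤₚ.+-identityˡ _)))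
            (sym (trans (dilate-⊕ (λ n → a 0 *ℤ b (suc n)) (λ n → antidiagonal n (λ i j → a (suc i) *ℤ b j)) N)
                        (cong (_+ℤ dilate (λ n → antidiagonal n (λ i j → a (suc i) *ℤ b j)) N) (dilate-scale (a 0) (b ∘ suc) N))))

  dilate-^^ : ∀ a n → dilate (a ^^ n) ≈ dilate a ^^ n
  dilate-^^ a zero    = dilate-one
  dilate-^^ a (suc n) = ≈-trans (dilate-⊛ a (a ^^ n)) (⊛-cong (≈-refl {dilate a}) (dilate-^^ a n))

  dilate-monomial : ∀ e → dilate (monomial e) ≈ monomial (twice e)
  dilate-monomial zero    = ≈-trans (dilate-cong monomial-zero) (≈-trans dilate-one (≈-sym monomial-zero))
  dilate-monomial (suc e) =
    ≈-trans (dilate-cong (monomial-suc e))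
    (≈-trans (dilate-qTimes (monomial e))
    (≈-trans (qTimes-cong (qTimes-cong (dilate-monomial e)))
             (≈-sym (≈-trans (monomial-suc (suc (twice e))) (qTimes-cong (monomial-suc (twice e)))))))

  dilate-prod : ∀ g K → dilate (prod g K) ≈ prod (dilate ∘ g) K
  dilate-prod g zero    = dilate-one
  dilate-prod g (suc K) = ≈-trans (dilate-⊛ (prod g K) (g K)) (⊛-cong (dilate-prod g K) (≈-refl {dilate (g K)}))

  dilate-∏ : ∀ {g} → FactorsTendToOne g → dilate (∏ g) ≈ ∏ (dilate ∘ g)
  dilate-∏ {g} tg n = trans (dilate-cong[] (∏≈[]prod tg n n ℕₚ.≤-refl) n ℕₚ.≤-refl) (dilate-prod g n n)

  dilate-qFactor : ∀ s e m k → dilate (qFactor s e m k) ≈ qFactor s (twice e) (twice m) k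
  dilate-qFactor s e m k =
    ≈-trans (dilate-⊕ one _)
            (⊕-cong dilate-one (≈-trans (dilate-scale s _)
                                        (λ n → cong (s *ℤ_) (trans (dilate-monomial (e + m * k) n) (monomial-cong (twice-+-* e m k) n)))))

  dilate-qPoch : ∀ s e m → 1 ≤ e → 1 ≤ m → dilate (qPoch s e m) ≈ qPoch s (twice e) (twice m)
  dilate-qPoch s e m 1≤e 1≤m = ≈-trans (dilate-∏ (qFactor-tendsToOne s e m 1≤e 1≤m)) (∏-cong (dilate-qFactor s e m))

  dilate-inv : ∀ a → a 0 ≡ 1ℤ → dilate (inv a) ≈ inv (dilate a)
  dilate-inv a a₀≡1 =
    inverse-unique (dilate a) (dilate (inv a)) (inv (dilate a))
      (≈-trans (≈-sym (dilate-⊛ a (inv a))) (≈-trans (dilate-cong (⊛-inverseʳ a a₀≡1)) dilate-one))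
      (⊛-inverseʳ (dilate a) a₀≡1)

  coefficients-of-dissection : ∀ {a e o} → a ≈ dilate e ⊕ qTimes (dilate o) →
                               (∀ n → a (2 * n) ≡ e n) × (∀ n → a (2 * n + 1) ≡ o n)
  coefficients-of-dissection {a} {e} {o} a≈e⊕qo = even , odd
    where
    qTimes-dilate-twice : ∀ n → qTimes (dilate o) (twice n) ≡ 0ℤ
    qTimes-dilate-twice zero    = refl
    qTimes-dilate-twice (suc n) = dilate-suc-twice o n
    even : ∀ n → a (2 * n) ≡ e n
    even n =
      trans (cong a (sym (twice≡2* n)))
      (trans (a≈e⊕qo (twice n)) (trans (cong₂ _+ℤ_ (dilate-twice e n) (qTimes-dilate-twice n)) (ℤₚ.+-identityʳ (e n))))
    odd : ∀ n → a (2 * n + 1) ≡ o n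
    odd n =
      trans (cong a (trans (ℕₚ.+-comm (2 * n) 1) (cong suc (sym (twice≡2* n)))))
      (trans (a≈e⊕qo (suc (twice n))) (trans (cong₂ _+ℤ_ (dilate-suc-twice e n) (dilate-twice o n)) (ℤₚ.+-identityˡ (o n))))

open Dilation

module BilateralSums where

  open import Data.Integer.Solver using (module +-*-Solver)
  open +-*-Solver using (solve; _:=_; _:+_; _:*_; :-_; con)

  sumℤ : ℕ → (ℤ → ℤ) → ℤ
  sumℤ zero F = F (+ 0)
  sumℤ (suc B) F = F (-[1+ B ]) +ℤ sumℤ B F +ℤ F (+ suc B)

  sumℤ-cong-on : ∀ B {F G : ℤ → ℤ} → (∀ t → ∣ t ∣ ≤ B → F t ≡ G t) → sumℤ B F ≡ sumℤ B G
  sumℤ-cong-on zero p = p (+ 0) z≤n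
  sumℤ-cong-on (suc B) p = cong₂ _+ℤ_ (cong₂ _+ℤ_ (p -[1+ B ] ℕₚ.≤-refl) (sumℤ-cong-on B (λ t h → p t (ℕₚ.m≤n⇒m≤1+n h)))) (p (+ suc B) ℕₚ.≤-refl)

  sumℤ-cong : ∀ B {F G : ℤ → ℤ} → (∀ t → F t ≡ G t) → sumℤ B F ≡ sumℤ B G
  sumℤ-cong B p = sumℤ-cong-on B (λ t _ → p t)

  sumℤ-extend : ∀ B B′ {F : ℤ → ℤ} → (∀ t → B < ∣ t ∣ → F t ≡ 0ℤ) → B ≤ B′ → sumℤ B′ F ≡ sumℤ B F
  sumℤ-extend B B′ {F} p le = subst (λ x → sumℤ x F ≡ sumℤ B F) (ℕₚ.m∸n+n≡m le) (extend-by B p (B′ ∸ B))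
    where
    extend-by : ∀ B {F : ℤ → ℤ} → (∀ t → B < ∣ t ∣ → F t ≡ 0ℤ) → ∀ d → sumℤ (d + B) F ≡ sumℤ B F
    extend-by B p zero = refl
    extend-by B {F} p (suc d) = trans (cong₂ (λ x y → x +ℤ sumℤ (d + B) F +ℤ y) (p _ (s≤s (ℕₚ.m≤n+m B d))) (p _ (s≤s (ℕₚ.m≤n+m B d))))
       (trans (ℤₚ.+-identityʳ _) (trans (ℤₚ.+-identityˡ _) (extend-by B p d)))

  sumℤ-+ : ∀ B F G → sumℤ B (λ t → F t +ℤ G t) ≡ sumℤ B F +ℤ sumℤ B G
  sumℤ-+ zero F G = refl
  sumℤ-+ (suc B) F G = trans (cong (λ x → F -[1+ B ] +ℤ G -[1+ B ] +ℤ x +ℤ (F (+ suc B) +ℤ G (+ suc B))) (sumℤ-+ B F G))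
    (solve 6 (λ a b c d e f → a :+ b :+ (c :+ d) :+ (e :+ f) := a :+ c :+ e :+ (b :+ d :+ f)) refl (F -[1+ B ]) (G -[1+ B ]) (sumℤ B F) (sumℤ B G) (F (+ suc B)) (G (+ suc B)))

  sumℤ-*ˡ : ∀ B c F → sumℤ B (λ t → c *ℤ F t) ≡ c *ℤ sumℤ B F
  sumℤ-*ˡ zero c F = refl
  sumℤ-*ˡ (suc B) c F = trans (cong (λ x → c *ℤ F -[1+ B ] +ℤ x +ℤ c *ℤ F (+ suc B)) (sumℤ-*ˡ B c F))
    (solve 4 (λ c a b d → c :* a :+ c :* b :+ c :* d := c :* (a :+ b :+ d)) refl c (F -[1+ B ]) (sumℤ B F) (F (+ suc B)))

  sumℤ-*ʳ : ∀ B c F → sumℤ B (λ t → F t *ℤ c) ≡ sumℤ B F *ℤ c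
  sumℤ-*ʳ B c F = trans (sumℤ-cong B (λ t → ℤₚ.*-comm (F t) c)) (trans (sumℤ-*ˡ B c F) (ℤₚ.*-comm c _))

  sumℤ-zero : ∀ B {F : ℤ → ℤ} → (∀ t → F t ≡ 0ℤ) → sumℤ B F ≡ 0ℤ
  sumℤ-zero zero p = p _
  sumℤ-zero (suc B) p = trans (cong₂ _+ℤ_ (cong₂ _+ℤ_ (p _) (sumℤ-zero B p)) (p _)) refl

  sumℤ-swap : ∀ A B (H : ℤ → ℤ → ℤ) → sumℤ A (λ t → sumℤ B (λ u → H t u)) ≡ sumℤ B (λ u → sumℤ A (λ t → H t u))
  sumℤ-swap zero B H = refl
  sumℤ-swap (suc A) B H = trans (cong (λ x → sumℤ B (H -[1+ A ]) +ℤ x +ℤ sumℤ B (H (+ suc A))) (sumℤ-swap A B H))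
    (trans (cong (_+ℤ sumℤ B (H (+ suc A))) (sym (sumℤ-+ B (H -[1+ A ]) (λ u → sumℤ A (λ t → H t u)))))
    (sym (sumℤ-+ B (λ u → H -[1+ A ] u +ℤ sumℤ A (λ t → H t u)) (H (+ suc A)))))

  sumℤ-reflect : ∀ B F → sumℤ B (λ t → F (- t)) ≡ sumℤ B F
  sumℤ-reflect zero F = refl
  sumℤ-reflect (suc B) F = trans (cong (λ x → F (+ suc B) +ℤ x +ℤ F -[1+ B ]) (sumℤ-reflect B F))
    (solve 3 (λ a b c → a :+ b :+ c := c :+ b :+ a) refl (F (+ suc B)) (sumℤ B F) (F -[1+ B ]))

  sumℤ-shift₁ : ∀ B F → sumℤ B (λ u → F (u +ℤ 1ℤ)) +ℤ F (- (+ B)) ≡ sumℤ B F +ℤ F (+ suc B)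
  sumℤ-shift₁ zero F = ℤₚ.+-comm (F 1ℤ) (F 0ℤ)
  sumℤ-shift₁ (suc B) F =
    trans (cong₂ (λ x y → x +ℤ sumℤ B (λ u → F (u +ℤ 1ℤ)) +ℤ y +ℤ F -[1+ B ]) (cong F (-[1+]+1 B)) (cong F (+suc+1 B)))
    (trans (solve 4 (λ a s c d → a :+ s :+ c :+ d := (s :+ a) :+ c :+ d) refl (F (- (+ B))) (sumℤ B (λ u → F (u +ℤ 1ℤ))) (F (+ suc (suc B))) (F -[1+ B ]))
    (trans (cong (λ x → x +ℤ F (+ suc (suc B)) +ℤ F -[1+ B ]) (sumℤ-shift₁ B F))
    (solve 4 (λ s b c d → s :+ b :+ c :+ d := d :+ s :+ b :+ c) refl (sumℤ B F) (F (+ suc B)) (F (+ suc (suc B))) (F -[1+ B ]))))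
    where
    -[1+]+1 : ∀ B → -[1+ B ] +ℤ 1ℤ ≡ - (+ B)
    -[1+]+1 zero = refl
    -[1+]+1 (suc B) = refl

    +suc+1 : ∀ B → + suc B +ℤ 1ℤ ≡ + suc (suc B)
    +suc+1 B = cong (λ x → + suc x) (ℕₚ.+-comm B 1)

  sumℤ-translate-+ : ∀ n A B (F : ℤ → ℤ) → (∀ t → A < ∣ t ∣ → F t ≡ 0ℤ) → A + n ≤ B → sumℤ B (λ u → F (u +ℤ + n)) ≡ sumℤ B F
  sumℤ-translate-+ zero A B F vanishes le = sumℤ-cong B (λ u → cong F (ℤₚ.+-identityʳ u))
  sumℤ-translate-+ (suc n) A B F vanishes le =
    trans (sumℤ-cong B (λ u → cong F (trans (cong (u +ℤ_) (solve 1 (λ n → con 1ℤ :+ n := n :+ con 1ℤ) refl (+ n))) (sym (ℤₚ.+-assoc u (+ n) 1ℤ)))))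
    (trans (sumℤ-translate-+ n (suc A) B (λ x → F (x +ℤ 1ℤ)) vanish₁ (ℕₚ.≤-trans (ℕₚ.≤-reflexive (sym (ℕₚ.+-suc A n))) le))
    (trans (sym (ℤₚ.+-identityʳ _))
    (trans (cong (sumℤ B (λ x → F (x +ℤ 1ℤ)) +ℤ_) (sym (vanishes (- (+ B)) (ℕₚ.≤-trans (ℕₚ.≤-trans (s≤s (ℕₚ.m≤m+n A n)) (ℕₚ.≤-reflexive (sym (ℕₚ.+-suc A n)))) (ℕₚ.≤-trans le (ℕₚ.≤-reflexive (sym (ℤₚ.∣-i∣≡∣i∣ (+ B)))))))))
    (trans (sumℤ-shift₁ B F)
    (trans (cong (sumℤ B F +ℤ_) (vanishes (+ suc B) (s≤s (ℕₚ.≤-trans (ℕₚ.m≤m+n A (suc n)) le)))) (ℤₚ.+-identityʳ _))))))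
    where
    ∣i∣≤∣i+1∣+1 : ∀ t → ∣ t ∣ ≤ ∣ t +ℤ 1ℤ ∣ + 1
    ∣i∣≤∣i+1∣+1 t = ℕₚ.≤-trans (ℕₚ.≤-reflexive (cong ∣_∣ (sym (solve 1 (λ t → t :+ con 1ℤ :+ con (- 1ℤ) := t) refl t))))
                           (ℤₚ.∣i+j∣≤∣i∣+∣j∣ (t +ℤ 1ℤ) (- 1ℤ))
    vanish₁ : ∀ t → suc A < ∣ t ∣ → F (t +ℤ 1ℤ) ≡ 0ℤ
    vanish₁ t h = vanishes _ (ℕₚ.+-cancelʳ-≤ 1 (suc A) ∣ t +ℤ 1ℤ ∣ (ℕₚ.≤-trans (ℕₚ.≤-reflexive (ℕₚ.+-comm (suc A) 1)) (ℕₚ.≤-trans h (∣i∣≤∣i+1∣+1 t))))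

  sumℤ-translate : ∀ c A B (F : ℤ → ℤ) → (∀ t → A < ∣ t ∣ → F t ≡ 0ℤ) → A + ∣ c ∣ ≤ B → sumℤ B (λ u → F (u +ℤ c)) ≡ sumℤ B F
  sumℤ-translate (+ n) A B F vanishes le = sumℤ-translate-+ n A B F vanishes le
  sumℤ-translate -[1+ n ] A B F vanishes le =
    trans (sym (sumℤ-reflect B (λ u → F (u +ℤ -[1+ n ]))))
    (trans (sumℤ-cong B (λ u → cong F (solve 2 (λ u c → :- u :+ :- c := :- (u :+ c)) refl u (+ suc n))))
    (trans (sumℤ-translate-+ (suc n) A B (λ x → F (- x)) (λ t h → vanishes (- t) (ℕₚ.≤-trans h (ℕₚ.≤-reflexive (sym (ℤₚ.∣-i∣≡∣i∣ t))))) le)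
    (sumℤ-reflect B F)))

  evenℤ : ℤ → ℤ
  evenℤ v = + 2 *ℤ v
  oddℤ : ℤ → ℤ
  oddℤ v = + 2 *ℤ v +ℤ 1ℤ

  sumℤ-parity-split : ∀ W F → sumℤ (suc (twice W)) F ≡ sumℤ W (λ v → F (evenℤ v)) +ℤ sumℤ W (λ v → F (oddℤ v)) +ℤ F -[1+ twice W ]
  sumℤ-parity-split zero F = solve 3 (λ a b c → a :+ b :+ c := b :+ c :+ a) refl (F -[1+ 0 ]) (F (+ 0)) (F (+ 1))
  sumℤ-parity-split (suc W) F =
    trans (cong (λ x → F -[1+ suc (suc (twice W)) ] +ℤ (F -[1+ suc (twice W) ] +ℤ x +ℤ F (+ suc (suc (twice W)))) +ℤ F (+ suc (suc (suc (twice W))))) (sumℤ-parity-split W F))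
    (trans (solve 7 (λ a b se so c d e → a :+ (b :+ (se :+ so :+ c) :+ d) :+ e := b :+ se :+ d :+ (c :+ so :+ e) :+ a) refl
            (F -[1+ suc (suc (twice W)) ]) (F -[1+ suc (twice W) ]) (sumℤ W (λ v → F (evenℤ v))) (sumℤ W (λ v → F (oddℤ v))) (F -[1+ twice W ]) (F (+ suc (suc (twice W)))) (F (+ suc (suc (suc (twice W))))))
    (cong₂ (λ x y → x +ℤ y +ℤ F -[1+ suc (suc (twice W)) ])
       (cong₂ (λ x y → x +ℤ sumℤ W (λ v → F (evenℤ v)) +ℤ y) (cong F (sym (evenℤ-negsuc W))) (cong F (sym (evenℤ-suc W))))
       (cong₂ (λ x y → x +ℤ sumℤ W (λ v → F (oddℤ v)) +ℤ y) (cong F (sym (oddℤ-negsuc W))) (cong F (sym (oddℤ-suc W))))))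
    where
    +twice≡2* : ∀ W → + twice W ≡ + 2 *ℤ + W
    +twice≡2* zero = refl
    +twice≡2* (suc W) = trans (cong (λ x → 1ℤ +ℤ (1ℤ +ℤ x)) (+twice≡2* W)) (solve 1 (λ w → con 1ℤ :+ (con 1ℤ :+ con (+ 2) :* w) := con (+ 2) :* (con 1ℤ :+ w)) refl (+ W))

    evenℤ-negsuc : ∀ W → evenℤ -[1+ W ] ≡ -[1+ suc (twice W) ]
    evenℤ-negsuc W = trans (solve 1 (λ w → con (+ 2) :* :- (con 1ℤ :+ w) := :- (con 1ℤ :+ (con 1ℤ :+ con (+ 2) :* w))) refl (+ W))
                  (cong (λ x → - (1ℤ +ℤ (1ℤ +ℤ x))) (sym (+twice≡2* W)))
    oddℤ-negsuc : ∀ W → oddℤ -[1+ W ] ≡ -[1+ twice W ]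
    oddℤ-negsuc W = trans (solve 1 (λ w → con (+ 2) :* :- (con 1ℤ :+ w) :+ con 1ℤ := :- (con 1ℤ :+ con (+ 2) :* w)) refl (+ W))
                  (cong (λ x → - (1ℤ +ℤ x)) (sym (+twice≡2* W)))
    evenℤ-suc : ∀ W → evenℤ (+ suc W) ≡ + suc (suc (twice W))
    evenℤ-suc W = trans (solve 1 (λ w → con (+ 2) :* (con 1ℤ :+ w) := con 1ℤ :+ (con 1ℤ :+ con (+ 2) :* w)) refl (+ W))
                  (cong (λ x → 1ℤ +ℤ (1ℤ +ℤ x)) (sym (+twice≡2* W)))
    oddℤ-suc : ∀ W → oddℤ (+ suc W) ≡ + suc (suc (suc (twice W)))
    oddℤ-suc W = trans (solve 1 (λ w → con (+ 2) :* (con 1ℤ :+ w) :+ con 1ℤ := con 1ℤ :+ (con 1ℤ :+ (con 1ℤ :+ con (+ 2) :* w))) refl (+ W))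
                  (cong (λ x → 1ℤ +ℤ (1ℤ +ℤ (1ℤ +ℤ x))) (sym (+twice≡2* W)))

open BilateralSums

module JacobiTriple where

  open Series-Solver using (solve; _:=_; _:+_; _:*_; con; :-_)
  open ≈-Reasoning

  antidiagonalₛ : ℕ → (ℕ → ℕ → Series) → Series
  antidiagonalₛ N H n = antidiagonal N (λ i j → H i j n)

  antidiagonalₛ-cong-on : ∀ N {H H′} → (∀ i j → i + j ≡ N → H i j ≈ H′ i j) → antidiagonalₛ N H ≈ antidiagonalₛ N H′
  antidiagonalₛ-cong-on N p n = antidiagonal-cong-on N (λ i j e → p i j e n)

  antidiagonalₛ-⊕ : ∀ N H H′ → antidiagonalₛ N (λ i j → H i j ⊕ H′ i j) ≈ antidiagonalₛ N H ⊕ antidiagonalₛ N H′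
  antidiagonalₛ-⊕ N H H′ n = antidiagonal-+ N (λ i j → H i j n) (λ i j → H′ i j n)

  antidiagonalₛ-⊛ : ∀ N H a → antidiagonalₛ N H ⊛ a ≈ antidiagonalₛ N (λ i j → H i j ⊛ a)
  antidiagonalₛ-⊛ zero H a = ≈-refl
  antidiagonalₛ-⊛ (suc N) H a = ≈-trans (⊛-distribʳ a (H 0 (suc N)) (antidiagonalₛ N (λ i j → H (suc i) j)))
     (⊕-cong (≈-refl {H 0 (suc N) ⊛ a}) (antidiagonalₛ-⊛ N (λ i j → H (suc i) j) a))

  antidiagonalₛ-split : ∀ N (H L R : ℕ → ℕ → Series) → (∀ i j → i + j ≡ suc N → H i j ≈ L i j ⊕ R i j)
    → (∀ j → L 0 j ≈ 0ₛ) → (∀ i → R i 0 ≈ 0ₛ)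
    → antidiagonalₛ (suc N) H ≈ antidiagonalₛ N (λ i j → L (suc i) j) ⊕ antidiagonalₛ N (λ i j → R i (suc j))
  antidiagonalₛ-split N H L R split L₀≈0 R₀≈0 n =
    trans (antidiagonal-cong-on (suc N) (λ i j e → split i j e n))
    (trans (antidiagonal-+ (suc N) (λ i j → L i j n) (λ i j → R i j n))
    (cong₂ _+ℤ_ (trans (cong (_+ℤ antidiagonal N (λ i j → L (suc i) j n)) (L₀≈0 (suc N) n)) (ℤₚ.+-identityˡ (antidiagonal N (λ i j → L (suc i) j n))))
                (trans (antidiagonal-unsnoc N (λ i j → R i j n)) (trans (cong (antidiagonal N (λ i j → R i (suc j) n) +ℤ_) (R₀≈0 (suc N) n)) (ℤₚ.+-identityʳ (antidiagonal N (λ i j → R i (suc j) n)))))))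

  thetaSeries : (ℤ → ℕ) → (ℤ → ℤ) → Series
  thetaSeries e σ N = sumℤ N (λ t → σ t *ℤ monomial (e t) N)

  triangular : ℕ → ℕ
  triangular zero = zero
  triangular (suc k) = triangular k + k

  module JacobiTripleProduct (s : ℤ) (s²≡1 : s *ℤ s ≡ 1ℤ) (α β : ℕ) (1≤α : 1 ≤ α) (1≤β : 1 ≤ β) where

    m : ℕ
    m = α + β

    qm^ : ℕ → Series
    qm^ k = monomial (m * k)

    qm^-⊛ : ∀ a b → qm^ a ⊛ qm^ b ≈ qm^ (a + b)
    qm^-⊛ a b = ≈-trans (monomial-⊛-monomial (m * a) (m * b)) (λ n → cong (λ x → monomial x n) (sym (ℕₚ.*-distribˡ-+ m a b)))

    qm^-zero : qm^ 0 ≈ one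
    qm^-zero n = trans (cong (λ x → monomial x n) (ℕₚ.*-zeroʳ m)) (monomial-zero n)

    -- The Gaussian binomial coefficient [i + j choose i] in the variable q^m.
    gauss : ℕ → ℕ → Series
    gauss zero j = one
    gauss (suc i) zero = one
    gauss (suc i) (suc j) = gauss i (suc j) ⊕ qm^ (suc i) ⊛ gauss (suc i) j

    gauss-zero : ∀ i → gauss i 0 ≈ one
    gauss-zero zero = ≈-refl
    gauss-zero (suc i) = ≈-refl

    gauss-pascal′ : ∀ i j → gauss (suc i) (suc j) ≈ qm^ (suc j) ⊛ gauss i (suc j) ⊕ gauss (suc i) j
    gauss-pascal′ zero zero n = ℤₚ.+-comm (one n) ((qm^ 1 ⊛ one) n)
    gauss-pascal′ zero (suc j) = begin
        one ⊕ qm^ 1 ⊛ gauss 1 (suc j)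
      ≈⟨ ⊕-cong (≈-refl {one}) (⊛-cong (≈-refl {qm^ 1}) (gauss-pascal′ zero j)) ⟩
        one ⊕ qm^ 1 ⊛ (qm^ (suc j) ⊛ one ⊕ gauss 1 j)
      ≈⟨ solve 4 (λ p q a b → a :+ p :* (q :* a :+ b) := (p :* q) :* a :+ (a :+ p :* b)) ≈-refl (qm^ 1) (qm^ (suc j)) one (gauss 1 j) ⟩
        (qm^ 1 ⊛ qm^ (suc j)) ⊛ one ⊕ (one ⊕ qm^ 1 ⊛ gauss 1 j)
      ≈⟨ ⊕-cong (⊛-cong (qm^-⊛ 1 (suc j)) (≈-refl {one})) (≈-refl {gauss 1 (suc j)}) ⟩
        qm^ (suc (suc j)) ⊛ one ⊕ gauss 1 (suc j) ∎
    gauss-pascal′ (suc i) zero = begin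
        gauss (suc i) 1 ⊕ qm^ (suc (suc i)) ⊛ one
      ≈⟨ ⊕-cong (gauss-pascal′ i zero) (≈-refl {qm^ (suc (suc i)) ⊛ one}) ⟩
        (qm^ 1 ⊛ gauss i 1 ⊕ one) ⊕ qm^ (suc (suc i)) ⊛ one
      ≈⟨ ⊕-cong (≈-refl {qm^ 1 ⊛ gauss i 1 ⊕ one}) (⊛-cong (≈-sym (qm^-⊛ 1 (suc i))) (≈-refl {one})) ⟩
        (qm^ 1 ⊛ gauss i 1 ⊕ one) ⊕ (qm^ 1 ⊛ qm^ (suc i)) ⊛ one
      ≈⟨ solve 4 (λ p a u o → (p :* a :+ o) :+ (p :* u) :* o := p :* (a :+ u :* o) :+ o) ≈-refl (qm^ 1) (gauss i 1) (qm^ (suc i)) one ⟩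
        qm^ 1 ⊛ gauss (suc i) 1 ⊕ one ∎
    gauss-pascal′ (suc i) (suc j) = begin
        gauss (suc i) (suc (suc j)) ⊕ Q ⊛ gauss (suc (suc i)) (suc j)
      ≈⟨ ⊕-cong (gauss-pascal′ i (suc j)) (⊛-cong (≈-refl {Q}) (gauss-pascal′ (suc i) j)) ⟩
        (P ⊛ a ⊕ b) ⊕ Q ⊛ (R ⊛ b ⊕ c)
      ≈⟨ solve 6 (λ P a b Q R c → (P :* a :+ b) :+ Q :* (R :* b :+ c) := P :* a :+ b :+ Q :* c :+ (Q :* R) :* b) ≈-refl P a b Q R c ⟩
        P ⊛ a ⊕ b ⊕ Q ⊛ c ⊕ (Q ⊛ R) ⊛ b
      ≈⟨ ⊕-cong (≈-refl {P ⊛ a ⊕ b ⊕ Q ⊛ c}) (⊛-cong QR (≈-refl {b})) ⟩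
        P ⊛ a ⊕ b ⊕ Q ⊛ c ⊕ (P ⊛ qm^ (suc i)) ⊛ b
      ≈⟨ solve 6 (λ P a b Q U c → P :* a :+ b :+ Q :* c :+ (P :* U) :* b := P :* (a :+ U :* b) :+ (b :+ Q :* c)) ≈-refl P a b Q (qm^ (suc i)) c ⟩
        P ⊛ gauss (suc i) (suc (suc j)) ⊕ gauss (suc (suc i)) (suc j) ∎
      where
      P Q R a b c : Series
      P = qm^ (suc (suc j))
      Q = qm^ (suc (suc i))
      R = qm^ (suc j)
      a = gauss i (suc (suc j))
      b = gauss (suc i) (suc j)
      c = gauss (suc (suc i)) j
      swap-shift : ∀ i j → (2 + i) + (1 + j) ≡ (2 + j) + (1 + i)
      swap-shift = ℕ-Solver.solve-∀
      QR : Q ⊛ R ≈ P ⊛ qm^ (suc i)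
      QR = ≈-trans (qm^-⊛ (suc (suc i)) (suc j)) (≈-trans (λ n → cong (λ x → qm^ x n) (swap-shift i j)) (≈-sym (qm^-⊛ (suc (suc j)) (suc i))))

    gauss-split₁ : ∀ N (c : ℕ → Series) → antidiagonalₛ (suc N) (λ i j → c i ⊛ gauss i j)
             ≈ antidiagonalₛ N (λ i j → c (suc i) ⊛ gauss i j) ⊕ antidiagonalₛ N (λ i j → c i ⊛ (qm^ i ⊛ gauss i j))
    gauss-split₁ N c = antidiagonalₛ-split N (λ i j → c i ⊛ gauss i j) L R split (λ j → ≈-refl) (λ i → ≈-refl)
      where
      L : ℕ → ℕ → Series
      L zero j = 0ₛ
      L (suc i) j = c (suc i) ⊛ gauss i j
      R : ℕ → ℕ → Series
      R i zero = 0ₛ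
      R i (suc j) = c i ⊛ (qm^ i ⊛ gauss i j)
      split : ∀ i j → i + j ≡ suc N → c i ⊛ gauss i j ≈ L i j ⊕ R i j
      split zero (suc j) _ = ≈-trans (⊛-cong (≈-refl {c 0}) (≈-trans (≈-sym (⊛-identityˡ one)) (⊛-cong (≈-sym qm^-zero) (≈-refl {one}))))
                            (λ n → sym (ℤₚ.+-identityˡ _))
      split (suc i) zero _ = ≈-trans (⊛-cong (≈-refl {c (suc i)}) (≈-sym (gauss-zero i))) (λ n → sym (ℤₚ.+-identityʳ _))
      split (suc i) (suc j) _ = ⊛-distribˡ (c (suc i)) (gauss i (suc j)) (qm^ (suc i) ⊛ gauss (suc i) j)

    gauss-split₂ : ∀ N (c : ℕ → Series) → antidiagonalₛ (suc N) (λ i j → c i ⊛ gauss i j)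
             ≈ antidiagonalₛ N (λ i j → c i ⊛ gauss i j) ⊕ antidiagonalₛ N (λ i j → c (suc i) ⊛ (qm^ j ⊛ gauss i j))
    gauss-split₂ N c = ≈-trans (antidiagonalₛ-split N (λ i j → c i ⊛ gauss i j) L R split (λ j → ≈-refl) (λ i → ≈-refl))
                        (λ n → ℤₚ.+-comm (antidiagonalₛ N (λ i j → L (suc i) j) n) _)
      where
      L : ℕ → ℕ → Series
      L zero j = 0ₛ
      L (suc i) j = c (suc i) ⊛ (qm^ j ⊛ gauss i j)
      R : ℕ → ℕ → Series
      R i zero = 0ₛ
      R i (suc j) = c i ⊛ gauss i j
      split : ∀ i j → i + j ≡ suc N → c i ⊛ gauss i j ≈ L i j ⊕ R i j
      split zero (suc j) _ = λ n → sym (ℤₚ.+-identityˡ _)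
      split (suc i) zero _ = ≈-trans (⊛-cong (≈-refl {c (suc i)}) (≈-trans (≈-sym (⊛-identityˡ one)) (⊛-cong (≈-sym qm^-zero) (≈-sym (gauss-zero i)))))
                            (λ n → sym (ℤₚ.+-identityʳ _))
      split (suc i) (suc j) _ = ≈-trans (⊛-cong (≈-refl {c (suc i)}) (gauss-pascal′ i j))
                                 (⊛-distribˡ (c (suc i)) (qm^ (suc j) ⊛ gauss i (suc j)) (gauss (suc i) j))

    -- term i b is the summand s^|t| q^(m t(t-1)/2 + α t) of the triple product with index t = i - b.
    exponent : ℕ → ℕ → ℕ
    exponent zero b = m * triangular b + β * b
    exponent (suc i) zero = m * triangular (suc i) + α * suc i
    exponent (suc i) (suc b) = exponent i b

    exponent-zero : ∀ i → exponent i 0 ≡ m * triangular i + α * i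
    exponent-zero zero = cong (_+_ (m * 0)) (trans (ℕₚ.*-zeroʳ β) (sym (ℕₚ.*-zeroʳ α)))
    exponent-zero (suc i) = refl

    add-m-to-both : ∀ x y z w c → x + m * y ≡ z + m * w + c → x + m * suc y ≡ z + m * suc w + c
    add-m-to-both x y z w c eq =
      trans (cong (_+_ x) (ℕₚ.*-suc m y))
      (trans (regroup₁ x m (m * y))
      (trans (cong (_+ m) eq)
      (trans (regroup₂ z (m * w) c m) (cong (λ v → z + v + c) (sym (ℕₚ.*-suc m w))))))
      where
      regroup₁ : ∀ x y u → x + (y + u) ≡ x + u + y
      regroup₁ = ℕ-Solver.solve-∀
      regroup₂ : ∀ z v c y → z + v + c + y ≡ z + (y + v) + c
      regroup₂ = ℕ-Solver.solve-∀

    exponent-suc₁ : ∀ i b → exponent (suc i) b + m * b ≡ exponent i b + m * i + α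
    exponent-suc₁ i       zero    rewrite exponent-zero i = arith α β (triangular i) i
      where
      arith : ∀ a b t i → (a + b) * (t + i) + a * (1 + i) + (a + b) * 0 ≡ (a + b) * t + a * i + (a + b) * i + a
      arith = ℕ-Solver.solve-∀
    exponent-suc₁ zero    (suc b) = arith α β (triangular b) b
      where
      arith : ∀ a b′ t b → (a + b′) * t + b′ * b + (a + b′) * (1 + b) ≡ (a + b′) * (t + b) + b′ * (1 + b) + (a + b′) * 0 + a
      arith = ℕ-Solver.solve-∀
    exponent-suc₁ (suc i) (suc b) = add-m-to-both (exponent (suc i) b) b (exponent i b) i α (exponent-suc₁ i b)

    exponent-suc₂ : ∀ i b → exponent i (suc b) + m * i ≡ exponent i b + m * b + β
    exponent-suc₂ zero    b       = arith α β (triangular b) b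
      where
      arith : ∀ a b′ t b → (a + b′) * (t + b) + b′ * (1 + b) + (a + b′) * 0 ≡ (a + b′) * t + b′ * b + (a + b′) * b + b′
      arith = ℕ-Solver.solve-∀
    exponent-suc₂ (suc i) zero    rewrite exponent-zero i = arith α β (triangular i) i
      where
      arith : ∀ a b t i → (a + b) * t + a * i + (a + b) * (1 + i) ≡ (a + b) * (t + i) + a * (1 + i) + (a + b) * 0 + b
      arith = ℕ-Solver.solve-∀
    exponent-suc₂ (suc i) (suc b) = add-m-to-both (exponent i (suc b)) i (exponent i b) b β (exponent-suc₂ i b)

    sign : ℕ → ℕ → ℤ
    sign zero b = s ^ℤ b
    sign (suc i) zero = s ^ℤ suc i
    sign (suc i) (suc b) = sign i b

    s*s* : ∀ x → s *ℤ (s *ℤ x) ≡ x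
    s*s* x = trans (sym (ℤₚ.*-assoc s s x)) (trans (cong (_*ℤ x) s²≡1) (ℤₚ.*-identityˡ x))

    sign-suc₁ : ∀ i b → s *ℤ sign i b ≡ sign (suc i) b
    sign-suc₁ zero zero = refl
    sign-suc₁ (suc i) zero = refl
    sign-suc₁ zero (suc b) = s*s* (s ^ℤ b)
    sign-suc₁ (suc i) (suc b) = sign-suc₁ i b

    sign-suc₂ : ∀ i b → s *ℤ sign i b ≡ sign i (suc b)
    sign-suc₂ zero b = refl
    sign-suc₂ (suc i) zero = trans (s*s* (s ^ℤ i)) (sym (Sg0 i))
      where
      Sg0 : ∀ i → sign i 0 ≡ s ^ℤ i
      Sg0 zero = refl
      Sg0 (suc i) = refl
    sign-suc₂ (suc i) (suc b) = sign-suc₂ i b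

    term : ℕ → ℕ → Series
    term i b = scale (sign i b) (monomial (exponent i b))

    scaled-monomial-cong : ∀ {c c′ e e′} → c ≡ c′ → e ≡ e′ → scale c (monomial e) ≈ scale c′ (monomial e′)
    scaled-monomial-cong refl refl = ≈-refl

    term-shift₁ : ∀ a b i j → i + j ≡ a + b → term i b ⊛ scale s (monomial (α + m * a)) ≈ qm^ j ⊛ term (suc i) b
    term-shift₁ a b i j i+j≡a+b = ≈-trans (scale-monomial-⊛ (sign i b) s (exponent i b) (α + m * a))
       (≈-trans (scaled-monomial-cong (trans (ℤₚ.*-comm (sign i b) s) (sign-suc₁ i b)) ex) (≈-sym (monomial-⊛-scale (m * j)  (sign (suc i) b) (exponent (suc i) b))))
      where
      ex : exponent i b + (α + m * a) ≡ m * j + exponent (suc i) b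
      ex = ℕₚ.+-cancelʳ-≡ (m * b) _ _
        (trans (regroup₁ (exponent i b) α (m * a) (m * b))
        (trans (cong (λ x → exponent i b + α + x) (trans (sym (ℕₚ.*-distribˡ-+ m a b)) (trans (cong (m *_) (sym i+j≡a+b)) (ℕₚ.*-distribˡ-+ m i j))))
        (trans (regroup₂ (exponent i b) α (m * i) (m * j))
        (trans (cong (_+_ (m * j)) (sym (exponent-suc₁ i b))) (sym (ℕₚ.+-assoc (m * j) _ _))))))
        where
        regroup₁ : ∀ e a x y → e + (a + x) + y ≡ e + a + (x + y)
        regroup₁ = ℕ-Solver.solve-∀
        regroup₂ : ∀ e a x y → e + a + (x + y) ≡ y + (e + x + a)
        regroup₂ = ℕ-Solver.solve-∀

    term-shift₂ : ∀ i b → term i b ⊛ scale s (monomial (β + m * b)) ≈ qm^ i ⊛ term i (suc b)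
    term-shift₂ i b = ≈-trans (scale-monomial-⊛ (sign i b) s (exponent i b) (β + m * b))
       (≈-trans (scaled-monomial-cong (trans (ℤₚ.*-comm (sign i b) s) (sign-suc₂ i b)) ex) (≈-sym (monomial-⊛-scale (m * i)  (sign i (suc b)) (exponent i (suc b)))))
      where
      ex : exponent i b + (β + m * b) ≡ m * i + exponent i (suc b)
      ex = trans (regroup (exponent i b) β (m * b))
           (trans (sym (exponent-suc₂ i b)) (ℕₚ.+-comm (exponent i (suc b)) (m * i)))
        where
        regroup : ∀ e x y → e + (x + y) ≡ e + y + x
        regroup = ℕ-Solver.solve-∀

    factor₁ : ℕ → Series
    factor₁ = qFactor s α m
    factor₂ : ℕ → Series
    factor₂ = qFactor s β m

    expansion : ℕ → ℕ → Series
    expansion a b = antidiagonalₛ (a + b) (λ i j → term i b ⊛ gauss i j)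

    distribute-factor : ∀ c g y → (c ⊛ g) ⊛ (one ⊕ y) ≈ c ⊛ g ⊕ (c ⊛ y) ⊛ g
    distribute-factor = solve 3 (λ c g y → (c :* g) :* (con 1ℤ :+ y) := c :* g :+ (c :* y) :* g) ≈-refl

    term-zero : term 0 0 ≈ one
    term-zero = ≈-trans (scaled-monomial-cong {sign 0 0} {1ℤ} {exponent 0 0} {0} refl (trans (cong₂ _+_ (ℕₚ.*-zeroʳ m) (ℕₚ.*-zeroʳ β)) refl))
            (≈-trans (scale-identityˡ (monomial 0)) monomial-zero)

    expansion-⊛-factor₂ : ∀ a b → expansion a b ⊛ factor₂ b ≈ expansion a (suc b)
    expansion-⊛-factor₂ a b = begin
        expansion a b ⊛ factor₂ b
      ≈⟨ antidiagonalₛ-⊛ (a + b) (λ i j → term i b ⊛ gauss i j) (factor₂ b) ⟩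
        antidiagonalₛ (a + b) (λ i j → (term i b ⊛ gauss i j) ⊛ factor₂ b)
      ≈⟨ antidiagonalₛ-cong-on (a + b) (λ i j _ → ≈-trans (distribute-factor (term i b) (gauss i j) (scale s (monomial (β + m * b))))
            (⊕-cong (≈-refl {term i b ⊛ gauss i j}) (≈-trans (⊛-cong (term-shift₂ i b) (≈-refl {gauss i j})) (⊛-assoc (qm^ i) (term i (suc b)) (gauss i j) )))) ⟩
        antidiagonalₛ (a + b) (λ i j → term i b ⊛ gauss i j ⊕ qm^ i ⊛ (term i (suc b) ⊛ gauss i j))
      ≈⟨ antidiagonalₛ-⊕ (a + b) _ _ ⟩
        antidiagonalₛ (a + b) (λ i j → term i b ⊛ gauss i j) ⊕ antidiagonalₛ (a + b) (λ i j → qm^ i ⊛ (term i (suc b) ⊛ gauss i j))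
      ≈⟨ ⊕-cong (≈-refl {antidiagonalₛ (a + b) (λ i j → term i b ⊛ gauss i j)}) (antidiagonalₛ-cong-on (a + b) (λ i j _ → ≈-trans (≈-sym (⊛-assoc (qm^ i) (term i (suc b)) (gauss i j)))
            (≈-trans (⊛-cong (⊛-comm (qm^ i) (term i (suc b))) (≈-refl {gauss i j})) (⊛-assoc (term i (suc b)) (qm^ i) (gauss i j))))) ⟩
        antidiagonalₛ (a + b) (λ i j → term i b ⊛ gauss i j) ⊕ antidiagonalₛ (a + b) (λ i j → term i (suc b) ⊛ (qm^ i ⊛ gauss i j))
      ≈⟨ ≈-sym (gauss-split₁ (a + b) (λ i → term i (suc b))) ⟩
        antidiagonalₛ (suc (a + b)) (λ i j → term i (suc b) ⊛ gauss i j)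
      ≈⟨ (λ n → cong (λ x → antidiagonalₛ x (λ i j → term i (suc b) ⊛ gauss i j) n) (sym (ℕₚ.+-suc a b))) ⟩
        expansion a (suc b) ∎

    expansion-⊛-factor₁ : ∀ a b → expansion a b ⊛ factor₁ a ≈ expansion (suc a) b
    expansion-⊛-factor₁ a b = begin
        expansion a b ⊛ factor₁ a
      ≈⟨ antidiagonalₛ-⊛ (a + b) (λ i j → term i b ⊛ gauss i j) (factor₁ a) ⟩
        antidiagonalₛ (a + b) (λ i j → (term i b ⊛ gauss i j) ⊛ factor₁ a)
      ≈⟨ antidiagonalₛ-cong-on (a + b) (λ i j h → ≈-trans (distribute-factor (term i b) (gauss i j) (scale s (monomial (α + m * a))))
            (⊕-cong (≈-refl {term i b ⊛ gauss i j}) (≈-trans (⊛-cong (term-shift₁ a b i j h) (≈-refl {gauss i j}))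
               (≈-trans (⊛-cong (⊛-comm (qm^ j) (term (suc i) b)) (≈-refl {gauss i j})) (⊛-assoc (term (suc i) b) (qm^ j) (gauss i j)))))) ⟩
        antidiagonalₛ (a + b) (λ i j → term i b ⊛ gauss i j ⊕ term (suc i) b ⊛ (qm^ j ⊛ gauss i j))
      ≈⟨ antidiagonalₛ-⊕ (a + b) _ _ ⟩
        antidiagonalₛ (a + b) (λ i j → term i b ⊛ gauss i j) ⊕ antidiagonalₛ (a + b) (λ i j → term (suc i) b ⊛ (qm^ j ⊛ gauss i j))
      ≈⟨ ≈-sym (gauss-split₂ (a + b) (λ i → term i b)) ⟩
        expansion (suc a) b ∎

    -- The finite form of the triple product, by induction on the number of factors: multiplying by one
    -- more factor shifts the index of each term, and the two q-Pascal rules reassemble the Gaussian binomials.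
    finite-triple-product : ∀ a b → prod factor₁ a ⊛ prod factor₂ b ≈ expansion a b
    finite-triple-product zero    zero    = ≈-trans (⊛-identityˡ one) (≈-trans (≈-sym term-zero) (≈-sym (⊛-identityʳ (term 0 0))))
    finite-triple-product a       (suc b) =
      ≈-trans (≈-sym (⊛-assoc (prod factor₁ a) (prod factor₂ b) (factor₂ b)))
      (≈-trans (⊛-cong (finite-triple-product a b) (≈-refl {factor₂ b})) (expansion-⊛-factor₂ a b))
    finite-triple-product (suc a) b       =
      ≈-trans (solve 3 (λ x y z → (x :* y) :* z := (x :* z) :* y) ≈-refl (prod factor₁ a) (factor₁ a) (prod factor₂ b))
      (≈-trans (⊛-cong (finite-triple-product a b) (≈-refl {factor₁ a})) (expansion-⊛-factor₁ a b))

    pochFactor : ℕ → Series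
    pochFactor = qFactor -1ℤ m m

    pochFactor≈ : ∀ k → pochFactor k ≈ one ⊕ neg (qm^ (suc k))
    pochFactor≈ k n = cong₂ _+ℤ_ (refl {x = one n}) (trans (ℤₚ.-1*i≡-i _) (cong (λ x → - monomial x n) (sym (ℕₚ.*-suc m k))))

    gauss-⊛-prod : ∀ i j → gauss i j ⊛ (prod pochFactor i ⊛ prod pochFactor j) ≈ prod pochFactor (i + j)
    gauss-⊛-prod zero j = ≈-trans (⊛-identityˡ _) (⊛-identityˡ _)
    gauss-⊛-prod (suc i) zero = ≈-trans (⊛-identityˡ _) (≈-trans (⊛-identityʳ _) (λ n → cong (λ x → prod pochFactor x n) (sym (ℕₚ.+-identityʳ (suc i)))))
    gauss-⊛-prod (suc i) (suc j) = begin
        (gauss i (suc j) ⊕ qm^ (suc i) ⊛ gauss (suc i) j) ⊛ ((Pi ⊛ pochFactor i) ⊛ (Pj ⊛ pochFactor j))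
      ≈⟨ solve 8 (λ a p b x u y v w → (a :+ p :* b) :* ((x :* u) :* (y :* v)) :=
                   (a :* (x :* (y :* v))) :* u :+ p :* (b :* ((x :* u) :* y)) :* v) ≈-refl
            (gauss i (suc j)) (qm^ (suc i)) (gauss (suc i) j) Pi (pochFactor i) Pj (pochFactor j) one ⟩
        (gauss i (suc j) ⊛ (Pi ⊛ (Pj ⊛ pochFactor j))) ⊛ pochFactor i ⊕ qm^ (suc i) ⊛ (gauss (suc i) j ⊛ ((Pi ⊛ pochFactor i) ⊛ Pj)) ⊛ pochFactor j
      ≈⟨ ⊕-cong (⊛-cong (gauss-⊛-prod i (suc j)) (≈-refl {pochFactor i})) (⊛-cong (⊛-cong (≈-refl {qm^ (suc i)}) (gauss-⊛-prod (suc i) j)) (≈-refl {pochFactor j})) ⟩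
        prod pochFactor (i + suc j) ⊛ pochFactor i ⊕ qm^ (suc i) ⊛ prod pochFactor (suc i + j) ⊛ pochFactor j
      ≈⟨ ⊕-cong (⊛-cong (λ n → cong (λ x → prod pochFactor x n) (ℕₚ.+-suc i j)) (≈-refl {pochFactor i})) (≈-refl {qm^ (suc i) ⊛ prod pochFactor (suc (i + j)) ⊛ pochFactor j}) ⟩
        M ⊛ pochFactor i ⊕ qm^ (suc i) ⊛ M ⊛ pochFactor j
      ≈⟨ ⊕-cong (⊛-cong (≈-refl {M}) (pochFactor≈ i)) (⊛-cong (≈-refl {qm^ (suc i) ⊛ M}) (pochFactor≈ j)) ⟩
        M ⊛ (one ⊕ neg (qm^ (suc i))) ⊕ qm^ (suc i) ⊛ M ⊛ (one ⊕ neg (qm^ (suc j)))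
      ≈⟨ solve 3 (λ x p q → x :* (con 1ℤ :+ :- p) :+ p :* x :* (con 1ℤ :+ :- q) := x :* (con 1ℤ :+ :- (p :* q))) ≈-refl M (qm^ (suc i)) (qm^ (suc j)) ⟩
        M ⊛ (one ⊕ neg (qm^ (suc i) ⊛ qm^ (suc j)))
      ≈⟨ ⊛-cong (≈-refl {M}) (⊕-cong (≈-refl {one}) (neg-cong (≈-trans (qm^-⊛ (suc i) (suc j)) (λ n → cong (λ x → qm^ x n) (cong suc (ℕₚ.+-suc i j)))))) ⟩
        M ⊛ (one ⊕ neg (qm^ (suc (suc (i + j)))))
      ≈⟨ ⊛-cong (≈-refl {M}) (≈-sym (pochFactor≈ (suc (i + j)))) ⟩
        prod pochFactor (suc (suc (i + j)))
      ≈⟨ (λ n → cong (λ x → prod pochFactor x n) (cong suc (sym (ℕₚ.+-suc i j)))) ⟩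
        prod pochFactor (suc i + suc j) ∎
      where
      Pi Pj M : Series
      Pi = prod pochFactor i
      Pj = prod pochFactor j
      M = prod pochFactor (suc (i + j))

    1≤m : 1 ≤ m
    1≤m = ℕₚ.≤-trans 1≤α (ℕₚ.m≤m+n α β)

    index≤exponent₁ : ∀ i b → i ≤ b + exponent i b
    index≤exponent₁ zero b = z≤n
    index≤exponent₁ (suc i) zero = ℕₚ.≤-trans (ℕₚ.≤-trans (ℕₚ.≤-reflexive (sym (ℕₚ.*-identityˡ (suc i)))) (ℕₚ.*-monoˡ-≤ (suc i) 1≤α)) (ℕₚ.m≤n+m (α * suc i) (m * triangular (suc i)))
    index≤exponent₁ (suc i) (suc b) = s≤s (index≤exponent₁ i b)

    index≤exponent₂ : ∀ i b → b ≤ i + exponent i b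
    index≤exponent₂ i zero = z≤n
    index≤exponent₂ zero (suc b) = ℕₚ.≤-trans (ℕₚ.≤-trans (ℕₚ.≤-reflexive (sym (ℕₚ.*-identityˡ (suc b)))) (ℕₚ.*-monoˡ-≤ (suc b) 1≤β)) (ℕₚ.m≤n+m (β * suc b) (m * triangular (suc b)))
    index≤exponent₂ (suc i) (suc b) = s≤s (index≤exponent₂ i b)

    term-vanishes : ∀ i b N → N < exponent i b → term i b ≈[ N ] 0ₛ
    term-vanishes i b N N<exponent k k≤N =
      trans (cong (sign i b *ℤ_) (monomial-below (ℕₚ.≤-<-trans k≤N N<exponent))) (ℤₚ.*-zeroʳ (sign i b))

    antidiagonalₛ-cong[] : ∀ M N {H H′ : ℕ → ℕ → Series} → (∀ i j → i + j ≡ M → H i j ≈[ N ] H′ i j) → antidiagonalₛ M H ≈[ N ] antidiagonalₛ M H′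
    antidiagonalₛ-cong[] M N p k h = antidiagonal-cong-on M (λ i j e → p i j e k h)

    truncation : ℕ → Series
    truncation b = antidiagonalₛ (b + b) (λ i j → term i b)

    Θ : Series
    Θ N = truncation N N

    truncation-unfold : ∀ b k → truncation (suc b) k ≡ term 0 (suc b) k +ℤ antidiagonal (suc (b + b)) (λ i j → term (suc i) (suc b) k)
    truncation-unfold b k rewrite ℕₚ.+-suc b b = refl

    truncation-step : ∀ b → truncation (suc b) ≈[ b ] truncation b
    truncation-step b k h =
      trans (truncation-unfold b k)
      (trans (cong (term 0 (suc b) k +ℤ_) (antidiagonal-unsnoc (b + b) (λ i j → term (suc i) (suc b) k)))
      (trans (cong₂ (λ x y → x +ℤ (truncation b k +ℤ y)) (term-vanishes 0 (suc b) b (index≤exponent₂ 0 (suc b)) k h) (term-vanishes (suc (b + b)) b b b<exponent k h))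
      (trans (ℤₚ.+-identityˡ _) (ℤₚ.+-identityʳ _))))
      where
      b<exponent : b < exponent (suc (b + b)) b
      b<exponent = ℕₚ.+-cancelˡ-≤ b (suc b) (exponent (suc (b + b)) b) (ℕₚ.≤-trans (ℕₚ.≤-reflexive (ℕₚ.+-suc b b)) (index≤exponent₁ (suc (b + b)) b))

    truncation-stable : ∀ N d → truncation (d + N) ≈[ N ] truncation N
    truncation-stable N zero = λ k _ → refl
    truncation-stable N (suc d) = ≈[]-trans (≈[]-weaken (ℕₚ.m≤n+m N d) (truncation-step (d + N))) (truncation-stable N d)

    truncation≈[]Θ : ∀ N n → N ≤ n → truncation n ≈[ N ] Θ
    truncation≈[]Θ N n le k h = subst (λ x → truncation x k ≡ truncation k k) (ℕₚ.m∸n+n≡m (ℕₚ.≤-trans h le)) (truncation-stable k (n ∸ k) k ℕₚ.≤-refl)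

    euler : Series
    euler = qPoch -1ℤ m m

    euler-factors : FactorsTendToOne pochFactor
    euler-factors = qFactor-tendsToOne -1ℤ m m 1≤m 1≤m

    gauss-⊛-euler : ∀ i j N → N ≤ i → N ≤ j → gauss i j ⊛ euler ≈[ N ] one
    gauss-⊛-euler i j N N≤i N≤j = ≈[]-trans (≈⇒≈[] N multiply-by-inverse) (≈[]-trans (⊛-cong[] gauss⊛euler²≈[]euler (≈[]-refl {inv euler})) (≈⇒≈[] N (⊛-inverseʳ euler refl)))
      where
      multiply-by-inverse : gauss i j ⊛ euler ≈ (gauss i j ⊛ (euler ⊛ euler)) ⊛ inv euler
      multiply-by-inverse = ≈-trans (≈-sym (⊛-identityʳ (gauss i j ⊛ euler))) (≈-trans (⊛-cong (≈-refl {gauss i j ⊛ euler}) (≈-sym (⊛-inverseʳ euler refl)))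
                (solve 3 (λ g p q → (g :* p) :* (p :* q) := (g :* (p :* p)) :* q) ≈-refl (gauss i j) euler (inv euler)))
      gauss⊛euler²≈[]euler : gauss i j ⊛ (euler ⊛ euler) ≈[ N ] euler
      gauss⊛euler²≈[]euler = ≈[]-trans (⊛-cong[] (≈[]-refl {gauss i j}) (⊛-cong[] (∏≈[]prod euler-factors N i N≤i) (∏≈[]prod euler-factors N j N≤j)))
              (≈[]-trans (≈⇒≈[] N (gauss-⊛-prod i j)) (≈[]-sym (∏≈[]prod euler-factors N (i + j) (ℕₚ.≤-trans N≤i (ℕₚ.m≤m+n i j)))))

    -- Multiplying the finite form by (q^m; q^m)_∞ turns every Gaussian binomial with both indices beyond N into
    -- 1 up to degree N, while terms of degree above N vanish.
    Θ≈product : Θ ≈ qPoch s α m ⊛ qPoch s β m ⊛ euler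
    Θ≈product N = sym (≈[]-trans truncate (≈[]-trans (≈⇒≈[] N expand) (≈[]-trans cancel (truncation≈[]Θ N n (ℕₚ.m≤m+n N N)))) N ℕₚ.≤-refl)
      where
      n : ℕ
      n = N + N
      factors₁ : FactorsTendToOne factor₁
      factors₁ = qFactor-tendsToOne s α m 1≤α 1≤m
      factors₂ : FactorsTendToOne factor₂
      factors₂ = qFactor-tendsToOne s β m 1≤β 1≤m
      truncate : qPoch s α m ⊛ qPoch s β m ⊛ euler ≈[ N ] (prod factor₁ n ⊛ prod factor₂ n) ⊛ euler
      truncate = ⊛-cong[] (⊛-cong[] (∏≈[]prod factors₁ N n (ℕₚ.m≤m+n N N)) (∏≈[]prod factors₂ N n (ℕₚ.m≤m+n N N))) (≈[]-refl {euler})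
      expand : (prod factor₁ n ⊛ prod factor₂ n) ⊛ euler ≈ antidiagonalₛ (n + n) (λ i j → (term i n ⊛ gauss i j) ⊛ euler)
      expand = ≈-trans (⊛-cong (finite-triple-product n n) (≈-refl {euler})) (antidiagonalₛ-⊛ (n + n) (λ i j → term i n ⊛ gauss i j) euler)
      cancel : antidiagonalₛ (n + n) (λ i j → (term i n ⊛ gauss i j) ⊛ euler) ≈[ N ] truncation n
      cancel = antidiagonalₛ-cong[] (n + n) N term⊛gauss⊛euler≈[]term
        where
        term⊛gauss⊛euler≈[]term : ∀ i j → i + j ≡ n + n → (term i n ⊛ gauss i j) ⊛ euler ≈[ N ] term i n
        term⊛gauss⊛euler≈[]term i j i+j≡n+n with exponent i n ℕₚ.≤? N
        ... | no exponent≰N =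
          ≈[]-trans (⊛-cong[] (⊛-cong[] (term-vanishes i n N (ℕₚ.≰⇒> exponent≰N)) (≈[]-refl {gauss i j})) (≈[]-refl {euler}))
          (≈[]-trans (≈⇒≈[] N (≈-trans (⊛-cong (≈-trans (⊛-comm 0ₛ (gauss i j)) (⊛-zeroʳ (gauss i j))) (≈-refl {euler}))
                                       (≈-trans (⊛-comm 0ₛ euler) (⊛-zeroʳ euler))))
                     (≈[]-sym (term-vanishes i n N (ℕₚ.≰⇒> exponent≰N))))
        ... | yes exponent≤N =
          ≈[]-trans (≈⇒≈[] N (⊛-assoc (term i n) (gauss i j) euler))
          (≈[]-trans (⊛-cong[] (≈[]-refl {term i n}) (gauss-⊛-euler i j N N≤i N≤j)) (≈⇒≈[] N (⊛-identityʳ (term i n))))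
          where
          -- a term of low degree has |i - n| ≤ exponent i n ≤ N, so with n = N + N both i and j exceed N
          N≤i : N ≤ i
          N≤i = ℕₚ.+-cancelʳ-≤ N N i (ℕₚ.≤-trans (index≤exponent₂ i n) (ℕₚ.+-monoʳ-≤ i exponent≤N))
          i≤n+N : i ≤ n + N
          i≤n+N = ℕₚ.≤-trans (index≤exponent₁ i n) (ℕₚ.+-monoʳ-≤ n exponent≤N)
          n+n≤n+[N+j] : n + n ≤ n + (N + j)
          n+n≤n+[N+j] = ℕₚ.≤-trans (ℕₚ.≤-reflexive (sym i+j≡n+n)) (ℕₚ.≤-trans (ℕₚ.+-monoˡ-≤ j i≤n+N) (ℕₚ.≤-reflexive (ℕₚ.+-assoc n N j)))
          N≤j : N ≤ j
          N≤j = ℕₚ.+-cancelˡ-≤ N N j (ℕₚ.+-cancelˡ-≤ n n (N + j) n+n≤n+[N+j])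

    index : ℕ → ℕ → ℤ
    index i zero = + i
    index zero (suc b) = -[1+ b ]
    index (suc i) (suc b) = index i b

    index-diagonal : ∀ b i → index (b + i) b ≡ + i
    index-diagonal zero i = refl
    index-diagonal (suc b) i = index-diagonal b i

    antidiagonal-index : ∀ N F → antidiagonal (N + N) (λ i j → F (index i N)) ≡ sumℤ N F
    antidiagonal-index zero F = refl
    antidiagonal-index (suc N) F rewrite ℕₚ.+-suc N N =
      trans (cong (F -[1+ N ] +ℤ_) (antidiagonal-unsnoc (N + N) (λ i j → F (index (suc i) (suc N)))))
      (trans (cong (λ x → F -[1+ N ] +ℤ (x +ℤ F (index (suc (N + N)) N))) (antidiagonal-index N F))
      (trans (sym (ℤₚ.+-assoc (F -[1+ N ]) (sumℤ N F) _))
      (cong (λ x → F -[1+ N ] +ℤ sumℤ N F +ℤ F x) (trans (cong (λ y → index y N) (sym (ℕₚ.+-suc N N))) (index-diagonal N (suc N))))))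

    exponentℤ : ℤ → ℕ
    exponentℤ (+ k) = exponent k 0
    exponentℤ -[1+ k ] = exponent 0 (suc k)

    signℤ : ℤ → ℤ
    signℤ (+ k) = sign k 0
    signℤ -[1+ k ] = sign 0 (suc k)

    exponent-index : ∀ i b → exponent i b ≡ exponentℤ (index i b)
    exponent-index zero zero = refl
    exponent-index zero (suc b) = refl
    exponent-index (suc i) zero = refl
    exponent-index (suc i) (suc b) = exponent-index i b

    sign-index : ∀ i b → sign i b ≡ signℤ (index i b)
    sign-index zero zero = refl
    sign-index zero (suc b) = refl
    sign-index (suc i) zero = refl
    sign-index (suc i) (suc b) = sign-index i b

    Θ≈thetaSeries : Θ ≈ thetaSeries exponentℤ signℤ
    Θ≈thetaSeries N = trans (antidiagonal-cong (N + N) (λ i j → cong₂ (λ a e → a *ℤ monomial e N) (sign-index i N) (exponent-index i N)))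
                   (antidiagonal-index N (λ t → signℤ t *ℤ monomial (exponentℤ t) N))

    ∣∣≤exponentℤ : ∀ t → ∣ t ∣ ≤ exponentℤ t
    ∣∣≤exponentℤ (+ k) = index≤exponent₁ k 0
    ∣∣≤exponentℤ -[1+ k ] = index≤exponent₂ 0 (suc k)

    jacobi-triple-product : thetaSeries exponentℤ signℤ ≈ qPoch s α m ⊛ qPoch s β m ⊛ qPoch -1ℤ m m
    jacobi-triple-product = ≈-trans (≈-sym Θ≈thetaSeries) Θ≈product

    signℤ≡s^∣∣ : ∀ t → signℤ t ≡ s ^ℤ ∣ t ∣
    signℤ≡s^∣∣ (+ zero) = refl
    signℤ≡s^∣∣ (+ suc k) = refl
    signℤ≡s^∣∣ -[1+ k ] = refl

    triangular-double : ∀ k → triangular k + triangular k + k ≡ k * k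
    triangular-double zero    = refl
    triangular-double (suc k) =
      trans (regroup (triangular k) k) (trans (cong (_+ (suc k + k)) (triangular-double k)) (square-suc k))
      where
      regroup : ∀ t k → (t + k) + (t + k) + (1 + k) ≡ (t + t + k) + (1 + k + k)
      regroup = ℕ-Solver.solve-∀
      square-suc : ∀ k → k * k + (1 + k + k) ≡ (1 + k) * (1 + k)
      square-suc = ℕ-Solver.solve-∀

    triangular-doubleℤ : ∀ k → + triangular k +ℤ + triangular k ≡ + k *ℤ + k -ℤ + k
    triangular-doubleℤ k =
      trans (arith (+ triangular k) (+ k)) (cong (_-ℤ + k) (trans (cong +_ (triangular-double k)) (ℤₚ.pos-* k k)))
      where
      arith : ∀ t k → t +ℤ t ≡ t +ℤ t +ℤ k -ℤ k
      arith = ℤ-Solver.solve-∀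

    module EvenPeriod (M : ℕ) (α+β≡M+M : α + β ≡ M + M) where

      quadratic : ℤ → ℤ
      quadratic t = + M *ℤ t *ℤ t +ℤ (+ α -ℤ + M) *ℤ t

      +exponent≡ : ∀ T c k → + (m * T + c * k) ≡ + M *ℤ (+ T +ℤ + T) +ℤ + c *ℤ + k
      +exponent≡ T c k =
        trans (ℤₚ.pos-+ (m * T) (c * k))
        (trans (cong₂ _+ℤ_ (trans (ℤₚ.pos-* m T) (cong (λ x → + x *ℤ + T) α+β≡M+M)) (ℤₚ.pos-* c k))
               (arith (+ M) (+ T) (+ c) (+ k)))
        where
        arith : ∀ M T c k → (M +ℤ M) *ℤ T +ℤ c *ℤ k ≡ M *ℤ (T +ℤ T) +ℤ c *ℤ k
        arith = ℤ-Solver.solve-∀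

      +β≡M+M-α : + β ≡ + M +ℤ + M -ℤ + α
      +β≡M+M-α = trans (arith (+ α) (+ β)) (cong (_-ℤ + α) (cong +_ α+β≡M+M))
        where
        arith : ∀ a b → b ≡ a +ℤ b -ℤ a
        arith = ℤ-Solver.solve-∀

      exponentℤ-quadratic : ∀ t → + exponentℤ t ≡ quadratic t
      exponentℤ-quadratic (+ k) =
        trans (cong +_ (exponent-zero k))
        (trans (+exponent≡ (triangular k) α k)
        (trans (cong (λ x → + M *ℤ x +ℤ + α *ℤ + k) (triangular-doubleℤ k)) (arith (+ M) (+ α) (+ k))))
        where
        arith : ∀ M a k → M *ℤ (k *ℤ k -ℤ k) +ℤ a *ℤ k ≡ M *ℤ k *ℤ k +ℤ (a -ℤ M) *ℤ k
        arith = ℤ-Solver.solve-∀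
      exponentℤ-quadratic -[1+ k ] =
        trans (+exponent≡ (triangular (suc k)) β (suc k))
        (trans (cong₂ (λ x b → + M *ℤ x +ℤ b *ℤ + suc k) (triangular-doubleℤ (suc k)) +β≡M+M-α)
               (arith (+ M) (+ α) (+ suc k)))
        where
        arith : ∀ M a K → M *ℤ (K *ℤ K -ℤ K) +ℤ (M +ℤ M -ℤ a) *ℤ K ≡ M *ℤ (- K) *ℤ (- K) +ℤ (a -ℤ M) *ℤ (- K)
        arith = ℤ-Solver.solve-∀

open JacobiTriple

module ThetaProducts where

  open import Data.Integer.Solver using (module +-*-Solver)
  open +-*-Solver using (solve; _:=_; _:+_; _:*_; :-_; con)

  antidiagonal-sumℤ : ∀ M B (H : ℕ → ℕ → ℤ → ℤ) → antidiagonal M (λ i j → sumℤ B (H i j)) ≡ sumℤ B (λ t → antidiagonal M (λ i j → H i j t))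
  antidiagonal-sumℤ zero B H = refl
  antidiagonal-sumℤ (suc M) B H = trans (cong (sumℤ B (H 0 (suc M)) +ℤ_) (antidiagonal-sumℤ M B (λ i j → H (suc i) j)))
     (sym (sumℤ-+ B (H 0 (suc M)) (λ t → antidiagonal M (λ i j → H (suc i) j t))))

  sumℤ-*-sumℤ : ∀ B f g → sumℤ B f *ℤ sumℤ B g ≡ sumℤ B (λ t → sumℤ B (λ u → f t *ℤ g u))
  sumℤ-*-sumℤ B f g = trans (sym (sumℤ-*ʳ B (sumℤ B g) f)) (sumℤ-cong B (λ t → sym (sumℤ-*ˡ B (f t) g)))

  thetaSeries-⊛ : ∀ ea eb σa σb → (∀ t → ∣ t ∣ ≤ ea t) → (∀ t → ∣ t ∣ ≤ eb t) → ∀ N →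
    (thetaSeries ea σa ⊛ thetaSeries eb σb) N ≡ sumℤ N (λ t → sumℤ N (λ u → σa t *ℤ σb u *ℤ monomial (ea t + eb u) N))
  thetaSeries-⊛ ea eb σa σb ba bb N =
    trans (⊛≡antidiagonal (thetaSeries ea σa) (thetaSeries eb σb) N)
    (trans (antidiagonal-cong-on N (λ i j e → cong₂ _*ℤ_ (sym (sumℤ-extend i N (λ t h → summand-vanishes ea σa ba i t h) (i≤N i j e)))
                                            (sym (sumℤ-extend j N (λ t h → summand-vanishes eb σb bb j t h) (j≤N i j e)))))
    (trans (antidiagonal-cong N (λ i j → sumℤ-*-sumℤ N _ _))
    (trans (antidiagonal-sumℤ N N _)
    (sumℤ-cong N (λ t → trans (antidiagonal-sumℤ N N _) (sumℤ-cong N (λ u → collect-monomials t u)))))))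
    where
    summand-vanishes : ∀ e σ → (∀ t → ∣ t ∣ ≤ e t) → ∀ i t → i < ∣ t ∣ → σ t *ℤ monomial (e t) i ≡ 0ℤ
    summand-vanishes e σ b i t h = trans (cong (σ t *ℤ_) (monomial-below (ℕₚ.<-≤-trans h (b t)))) (ℤₚ.*-zeroʳ (σ t))
    i≤N : ∀ i j → i + j ≡ N → i ≤ N
    i≤N i j e = ℕₚ.≤-trans (ℕₚ.m≤m+n i j) (ℕₚ.≤-reflexive e)
    j≤N : ∀ i j → i + j ≡ N → j ≤ N
    j≤N i j e = ℕₚ.≤-trans (ℕₚ.m≤n+m j i) (ℕₚ.≤-reflexive e)
    collect-monomials : ∀ t u → antidiagonal N (λ i j → σa t *ℤ monomial (ea t) i *ℤ (σb u *ℤ monomial (eb u) j)) ≡ σa t *ℤ σb u *ℤ monomial (ea t + eb u) N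
    collect-monomials t u = trans (antidiagonal-cong N (λ i j → solve 4 (λ a x b y → a :* x :* (b :* y) := a :* b :* (x :* y)) refl (σa t) (monomial (ea t) i) (σb u) (monomial (eb u) j)))
       (trans (antidiagonal-*ˡ N (σa t *ℤ σb u) _) (cong (σa t *ℤ σb u *ℤ_) (trans (sym (⊛≡antidiagonal (monomial (ea t)) (monomial (eb u)) N)) (monomial-⊛-monomial (ea t) (eb u) N))))

  -- In the coefficient of q^N of θ₁ θ₂, a double sum over (t, u), substitute u = t + d and split by the parity
  -- of d: the hypotheses match the even part with θ₃² and the odd part with q θ₄².
  module Schröter
    (e₁ e₂ e₃ e₄ : ℤ → ℕ) (σ₁ σ₂ σ₃ σ₄ : ℤ → ℤ)
    (bound₁ : ∀ t → ∣ t ∣ ≤ e₁ t) (bound₂ : ∀ t → ∣ t ∣ ≤ e₂ t) (bound₃ : ∀ t → ∣ t ∣ ≤ e₃ t) (bound₄ : ∀ t → ∣ t ∣ ≤ e₄ t)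
    (exponent-even : ∀ k v → e₁ (k +ℤ - v) + e₂ (evenℤ v +ℤ (k +ℤ - v)) ≡ e₃ k + e₃ (- v))
    (exponent-odd  : ∀ k v → e₁ (k +ℤ - v) + e₂ (oddℤ v +ℤ (k +ℤ - v)) ≡ suc (e₄ (- k) + e₄ (v +ℤ 1ℤ)))
    (sign-even : ∀ k v → σ₁ (k +ℤ - v) *ℤ σ₂ (evenℤ v +ℤ (k +ℤ - v)) ≡ σ₃ k *ℤ σ₃ (- v))
    (sign-odd  : ∀ k v → σ₁ (k +ℤ - v) *ℤ σ₂ (oddℤ v +ℤ (k +ℤ - v)) ≡ σ₄ (- k) *ℤ σ₄ (v +ℤ 1ℤ))
    where
    *-absorbs-zero : ∀ a b {x} → x ≡ 0ℤ → a *ℤ b *ℤ x ≡ 0ℤ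
    *-absorbs-zero a b refl = ℤₚ.*-zeroʳ (a *ℤ b)

    twice≡+ : ∀ N → twice N ≡ N + N
    twice≡+ zero = refl
    twice≡+ (suc N) = cong suc (trans (cong suc (twice≡+ N)) (sym (ℕₚ.+-suc N N)))

    module _ (N : ℕ) where
      pair : ℤ → ℤ → ℤ
      pair t u = σ₁ t *ℤ σ₂ u *ℤ monomial (e₁ t + e₂ u) N
      evenPair : ℤ → ℤ → ℤ
      evenPair k l = σ₃ k *ℤ σ₃ l *ℤ monomial (e₃ k + e₃ l) N
      oddPair : ℤ → ℤ → ℤ
      oddPair a b = σ₄ a *ℤ σ₄ b *ℤ monomial (suc (e₄ a + e₄ b)) N

      window : ℕ
      window = suc (twice N)

      N≤window : N ≤ window
      N≤window = ℕₚ.≤-trans (ℕₚ.m≤m+n N N) (ℕₚ.≤-trans (ℕₚ.≤-reflexive (sym (twice≡+ N))) (ℕₚ.n≤1+n _))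

      N+≤window : ∀ {x} → x ≤ N → N + x ≤ window
      N+≤window h = ℕₚ.≤-trans (ℕₚ.+-monoʳ-≤ N h) (ℕₚ.≤-trans (ℕₚ.≤-reflexive (sym (twice≡+ N))) (ℕₚ.n≤1+n _))

      pair-vanishes₁ : ∀ t u → N < ∣ t ∣ → pair t u ≡ 0ℤ
      pair-vanishes₁ t u h = *-absorbs-zero (σ₁ t) (σ₂ u) (monomial-below (ℕₚ.<-≤-trans h (ℕₚ.≤-trans (bound₁ t) (ℕₚ.m≤m+n (e₁ t) (e₂ u)))))
      pair-vanishes₂ : ∀ t u → N < ∣ u ∣ → pair t u ≡ 0ℤ
      pair-vanishes₂ t u h = *-absorbs-zero (σ₁ t) (σ₂ u) (monomial-below (ℕₚ.<-≤-trans h (ℕₚ.≤-trans (bound₂ u) (ℕₚ.m≤n+m (e₂ u) (e₁ t)))))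
      evenPair-vanishes : ∀ k l → N < ∣ k ∣ → evenPair k l ≡ 0ℤ
      evenPair-vanishes k l h = *-absorbs-zero (σ₃ k) (σ₃ l) (monomial-below (ℕₚ.<-≤-trans h (ℕₚ.≤-trans (bound₃ k) (ℕₚ.m≤m+n (e₃ k) (e₃ l)))))
      oddPair-vanishes₁ : ∀ a b → N ≤ ∣ a ∣ → oddPair a b ≡ 0ℤ
      oddPair-vanishes₁ a b h = *-absorbs-zero (σ₄ a) (σ₄ b) (monomial-below (s≤s (ℕₚ.≤-trans h (ℕₚ.≤-trans (bound₄ a) (ℕₚ.m≤m+n (e₄ a) (e₄ b))))))
      oddPair-vanishes₂ : ∀ a b → N ≤ ∣ b ∣ → oddPair a b ≡ 0ℤ
      oddPair-vanishes₂ a b h = *-absorbs-zero (σ₄ a) (σ₄ b) (monomial-below (s≤s (ℕₚ.≤-trans h (ℕₚ.≤-trans (bound₄ b) (ℕₚ.m≤n+m (e₄ b) (e₄ a))))))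

      diagonal : ℤ → ℤ
      diagonal d = sumℤ window (λ t → pair t (d +ℤ t))

      sum-by-diagonals : sumℤ N (λ t → sumℤ N (pair t)) ≡ sumℤ window (λ t → sumℤ window (λ d → pair t (d +ℤ t)))
      sum-by-diagonals = trans (sumℤ-cong N (λ t → sym (sumℤ-extend N window (pair-vanishes₂ t) N≤window)))
           (trans (sym (sumℤ-extend N window (λ t h → sumℤ-zero window (λ u → pair-vanishes₁ t u h)) N≤window))
           (sumℤ-cong window shear-row))
        where
        shear-row : ∀ t → sumℤ window (pair t) ≡ sumℤ window (λ d → pair t (d +ℤ t))
        shear-row t with N ℕₚ.<? ∣ t ∣
        ... | yes h = trans (sumℤ-zero window (λ u → pair-vanishes₁ t u h)) (sym (sumℤ-zero window (λ u → pair-vanishes₁ t _ h)))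
        ... | no h = sym (sumℤ-translate t N window (pair t) (pair-vanishes₂ t) (N+≤window (ℕₚ.≮⇒≥ h)))

      outer-diagonal-vanishes : diagonal -[1+ twice N ] ≡ 0ℤ
      outer-diagonal-vanishes = sumℤ-zero window vanishing-summand
        where
        vanishing-summand : ∀ t → pair t (-[1+ twice N ] +ℤ t) ≡ 0ℤ
        vanishing-summand t with N ℕₚ.<? ∣ t ∣
        ... | yes h = pair-vanishes₁ t _ h
        ... | no h = pair-vanishes₂ t _ (ℕₚ.+-cancelʳ-≤ N (suc N) _ (ℕₚ.≤-trans (ℕₚ.≤-reflexive (cong suc (sym (twice≡+ N)))) (ℕₚ.≤-trans twice< (ℕₚ.+-monoʳ-≤ _ (ℕₚ.≮⇒≥ h)))))
          where
          c : ℤ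
          c = -[1+ twice N ]
          twice< : suc (twice N) ≤ ∣ c +ℤ t ∣ + ∣ t ∣
          twice< = ℕₚ.≤-trans (ℕₚ.≤-reflexive (cong ∣_∣ (sym (solve 2 (λ c t → c :+ t :+ :- t := c) refl c t))))
                    (ℕₚ.≤-trans (ℤₚ.∣i+j∣≤∣i∣+∣j∣ (c +ℤ t) (- t)) (ℕₚ.≤-reflexive (cong (_+_ ∣ c +ℤ t ∣) (ℤₚ.∣-i∣≡∣i∣ t))))

      even-diagonals : sumℤ N (λ v → diagonal (evenℤ v)) ≡ (thetaSeries e₃ σ₃ ⊛ thetaSeries e₃ σ₃) N
      even-diagonals = trans (sumℤ-cong-on N (λ v hv → sym (sumℤ-translate (- v) N window (λ t → pair t (evenℤ v +ℤ t)) (λ t h → pair-vanishes₁ t _ h) (N+≤window (ℕₚ.≤-trans (ℕₚ.≤-reflexive (ℤₚ.∣-i∣≡∣i∣ v)) hv)))))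
           (trans (sumℤ-cong N (λ v → sumℤ-cong window (λ k → pt k v)))
           (trans (sumℤ-swap N window (λ v k → evenPair k (- v)))
           (trans (sumℤ-cong window (λ k → sumℤ-reflect N (evenPair k)))
           (trans (sumℤ-extend N window (λ k h → sumℤ-zero N (λ l → evenPair-vanishes k l h)) N≤window)
           (sym (thetaSeries-⊛ e₃ e₃ σ₃ σ₃ bound₃ bound₃ N))))))
        where
        pt : ∀ k v → pair (k +ℤ - v) (evenℤ v +ℤ (k +ℤ - v)) ≡ evenPair k (- v)
        pt k v = cong₂ _*ℤ_ (sign-even k v) (cong (λ x → monomial x N) (exponent-even k v))

      oddPairSum : ℤ
      oddPairSum = sumℤ N (λ a → sumℤ N (oddPair a))

      odd-diagonals : sumℤ N (λ v → diagonal (oddℤ v)) ≡ oddPairSum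
      odd-diagonals = trans (sumℤ-cong-on N (λ v hv → sym (sumℤ-translate (- v) N window (λ t → pair t (oddℤ v +ℤ t)) (λ t h → pair-vanishes₁ t _ h) (N+≤window (ℕₚ.≤-trans (ℕₚ.≤-reflexive (ℤₚ.∣-i∣≡∣i∣ v)) hv)))))
           (trans (sumℤ-cong N (λ v → sumℤ-cong window (λ k → pt k v)))
           (trans (sumℤ-cong N (λ v → sumℤ-reflect window (λ a → oddPair a (v +ℤ 1ℤ))))
           (trans (sumℤ-swap N window (λ v a → oddPair a (v +ℤ 1ℤ)))
           (trans (sumℤ-cong window sh)
           (sumℤ-extend N window (λ a h → sumℤ-zero N (λ b → oddPair-vanishes₁ a b (ℕₚ.<⇒≤ h))) N≤window)))))
        where
        pt : ∀ k v → pair (k +ℤ - v) (oddℤ v +ℤ (k +ℤ - v)) ≡ oddPair (- k) (v +ℤ 1ℤ)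
        pt k v = cong₂ _*ℤ_ (sign-odd k v) (cong (λ x → monomial x N) (exponent-odd k v))
        sh : ∀ a → sumℤ N (λ v → oddPair a (v +ℤ 1ℤ)) ≡ sumℤ N (oddPair a)
        sh a = trans (sym (ℤₚ.+-identityʳ _)) (trans (cong (sumℤ N (λ v → oddPair a (v +ℤ 1ℤ)) +ℤ_) (sym (oddPair-vanishes₂ a _ (ℕₚ.≤-reflexive (sym (ℤₚ.∣-i∣≡∣i∣ (+ N)))))))
               (trans (sumℤ-shift₁ N (oddPair a)) (trans (cong (sumℤ N (oddPair a) +ℤ_) (oddPair-vanishes₂ a _ (ℕₚ.n≤1+n N))) (ℤₚ.+-identityʳ _))))

    oddPairSum≡ : ∀ N → oddPairSum N ≡ qTimes (thetaSeries e₄ σ₄ ⊛ thetaSeries e₄ σ₄) N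
    oddPairSum≡ zero = ℤₚ.*-zeroʳ (σ₄ (+ 0) *ℤ σ₄ (+ 0))
    oddPairSum≡ (suc N) = trans (sumℤ-cong (suc N) (λ a → sumℤ-extend N (suc N) (λ b h → *-absorbs-zero (σ₄ a) (σ₄ b) (monomial-below (ℕₚ.<-≤-trans h (ℕₚ.≤-trans (bound₄ b) (ℕₚ.m≤n+m (e₄ b) (e₄ a)))))) (ℕₚ.n≤1+n N)))
       (trans (sumℤ-extend N (suc N) (λ a h → sumℤ-zero N (λ b → *-absorbs-zero (σ₄ a) (σ₄ b) (monomial-below (ℕₚ.<-≤-trans h (ℕₚ.≤-trans (bound₄ a) (ℕₚ.m≤m+n (e₄ a) (e₄ b))))))) (ℕₚ.n≤1+n N))
       (sym (thetaSeries-⊛ e₄ e₄ σ₄ σ₄ bound₄ bound₄ N)))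

    schröter : ∀ N → (thetaSeries e₁ σ₁ ⊛ thetaSeries e₂ σ₂) N ≡ (thetaSeries e₃ σ₃ ⊛ thetaSeries e₃ σ₃) N +ℤ qTimes (thetaSeries e₄ σ₄ ⊛ thetaSeries e₄ σ₄) N
    schröter N = trans (thetaSeries-⊛ e₁ e₂ σ₁ σ₂ bound₁ bound₂ N)
      (trans (sum-by-diagonals N)
      (trans (sumℤ-swap (window N) (window N) (λ t d → pair N t (d +ℤ t)))
      (trans (sumℤ-parity-split N (diagonal N))
      (trans (cong₂ (λ x y → x +ℤ y +ℤ diagonal N -[1+ twice N ]) (even-diagonals N) (trans (odd-diagonals N) (oddPairSum≡ N)))
      (trans (cong ((thetaSeries e₃ σ₃ ⊛ thetaSeries e₃ σ₃) N +ℤ qTimes (thetaSeries e₄ σ₄ ⊛ thetaSeries e₄ σ₄) N +ℤ_) (outer-diagonal-vanishes N)) (ℤₚ.+-identityʳ _))))))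

open ThetaProducts

module ThetaIdentities where

  open Series-Solver using (solve; _:=_; _:+_; _:*_; _:^_; con)

  parity : ℤ → ℤ
  parity t = -1ℤ ^ℤ ∣ t ∣

  parity-neg : ∀ t → parity (- t) ≡ parity t
  parity-neg t = cong (-1ℤ ^ℤ_) (ℤₚ.∣-i∣≡∣i∣ t)

  parity-suc : ∀ t → parity (t +ℤ 1ℤ) ≡ -1ℤ *ℤ parity t
  parity-suc (+ n)          = cong (-1ℤ ^ℤ_) (ℕₚ.+-comm n 1)
  parity-suc -[1+ zero ]    = refl
  parity-suc -[1+ suc n ]   = sym (trans (sym (ℤₚ.*-assoc -1ℤ -1ℤ _)) (ℤₚ.*-identityˡ _))

  parity-+-+ : ∀ t n → parity (t +ℤ + n) ≡ parity t *ℤ parity (+ n)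
  parity-+-+ t zero    = trans (cong parity (ℤₚ.+-identityʳ t)) (sym (ℤₚ.*-identityʳ (parity t)))
  parity-+-+ t (suc n) =
    trans (cong parity (regroup t (+ n)))
    (trans (parity-suc (t +ℤ + n))
    (trans (cong (-1ℤ *ℤ_) (parity-+-+ t n)) (swap -1ℤ (parity t) (parity (+ n)))))
    where
    regroup : ∀ t n → t +ℤ (1ℤ +ℤ n) ≡ t +ℤ n +ℤ 1ℤ
    regroup = ℤ-Solver.solve-∀
    swap : ∀ a b c → a *ℤ (b *ℤ c) ≡ b *ℤ (a *ℤ c)
    swap = ℤ-Solver.solve-∀

  parity-+ : ∀ t u → parity (t +ℤ u) ≡ parity t *ℤ parity u
  parity-+ t (+ n)    = parity-+-+ t n
  parity-+ t -[1+ n ] =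
    trans (cong parity (negate t (+ suc n)))
    (trans (parity-neg (- t +ℤ + suc n))
    (trans (parity-+-+ (- t) (suc n)) (cong (_*ℤ parity (+ suc n)) (parity-neg t))))
    where
    negate : ∀ t n → t +ℤ - n ≡ - (- t +ℤ n)
    negate = ℤ-Solver.solve-∀

  module J₁ = JacobiTripleProduct 1ℤ refl 1 5 ℕₚ.0<1+n ℕₚ.0<1+n
  module J₂ = JacobiTripleProduct -1ℤ refl 3 3 ℕₚ.0<1+n ℕₚ.0<1+n
  module J₃ = JacobiTripleProduct -1ℤ refl 4 8 ℕₚ.0<1+n ℕₚ.0<1+n
  module J₄ = JacobiTripleProduct -1ℤ refl 2 10 ℕₚ.0<1+n ℕₚ.0<1+n
  module Q₁ = J₁.EvenPeriod 3 refl
  module Q₂ = J₂.EvenPeriod 3 refl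
  module Q₃ = J₃.EvenPeriod 6 refl
  module Q₄ = J₄.EvenPeriod 6 refl

  -- θ₁ = Σ q^(3t²-2t), θ₂ = Σ (-1)^t q^(3t²), θ₃ = Σ (-1)^t q^(6t²-2t), θ₄ = Σ (-1)^t q^(6t²-4t).
  θ₁ θ₂ θ₃ θ₄ : Series
  θ₁ = thetaSeries J₁.exponentℤ J₁.signℤ
  θ₂ = thetaSeries J₂.exponentℤ J₂.signℤ
  θ₃ = thetaSeries J₃.exponentℤ J₃.signℤ
  θ₄ = thetaSeries J₄.exponentℤ J₄.signℤ

  exponent-even : ∀ k v → J₁.exponentℤ (k +ℤ - v) + J₂.exponentℤ (evenℤ v +ℤ (k +ℤ - v)) ≡ J₃.exponentℤ k + J₃.exponentℤ (- v)
  exponent-even k v = ℤₚ.+-injective (begin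
    + (J₁.exponentℤ (k +ℤ - v) + J₂.exponentℤ (evenℤ v +ℤ (k +ℤ - v)))
      ≡⟨ cong₂ _+ℤ_ (Q₁.exponentℤ-quadratic (k +ℤ - v)) (Q₂.exponentℤ-quadratic (evenℤ v +ℤ (k +ℤ - v))) ⟩
    Q₁.quadratic (k +ℤ - v) +ℤ Q₂.quadratic (evenℤ v +ℤ (k +ℤ - v))
      ≡⟨ identity k v ⟩
    Q₃.quadratic k +ℤ Q₃.quadratic (- v)
      ≡⟨ sym (cong₂ _+ℤ_ (Q₃.exponentℤ-quadratic k) (Q₃.exponentℤ-quadratic (- v))) ⟩
    + (J₃.exponentℤ k + J₃.exponentℤ (- v)) ∎)
    where
    open ≡-Reasoning
    identity : ∀ k v →
      (+ 3 *ℤ (k +ℤ - v) *ℤ (k +ℤ - v) +ℤ (+ 1 -ℤ + 3) *ℤ (k +ℤ - v))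
        +ℤ (+ 3 *ℤ (+ 2 *ℤ v +ℤ (k +ℤ - v)) *ℤ (+ 2 *ℤ v +ℤ (k +ℤ - v)) +ℤ (+ 3 -ℤ + 3) *ℤ (+ 2 *ℤ v +ℤ (k +ℤ - v)))
      ≡ (+ 6 *ℤ k *ℤ k +ℤ (+ 4 -ℤ + 6) *ℤ k) +ℤ (+ 6 *ℤ (- v) *ℤ (- v) +ℤ (+ 4 -ℤ + 6) *ℤ (- v))
    identity = ℤ-Solver.solve-∀

  exponent-odd : ∀ k v → J₁.exponentℤ (k +ℤ - v) + J₂.exponentℤ (oddℤ v +ℤ (k +ℤ - v)) ≡ suc (J₄.exponentℤ (- k) + J₄.exponentℤ (v +ℤ 1ℤ))
  exponent-odd k v = ℤₚ.+-injective (begin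
    + (J₁.exponentℤ (k +ℤ - v) + J₂.exponentℤ (oddℤ v +ℤ (k +ℤ - v)))
      ≡⟨ cong₂ _+ℤ_ (Q₁.exponentℤ-quadratic (k +ℤ - v)) (Q₂.exponentℤ-quadratic (oddℤ v +ℤ (k +ℤ - v))) ⟩
    Q₁.quadratic (k +ℤ - v) +ℤ Q₂.quadratic (oddℤ v +ℤ (k +ℤ - v))
      ≡⟨ identity k v ⟩
    1ℤ +ℤ (Q₄.quadratic (- k) +ℤ Q₄.quadratic (v +ℤ 1ℤ))
      ≡⟨ sym (cong (1ℤ +ℤ_) (cong₂ _+ℤ_ (Q₄.exponentℤ-quadratic (- k)) (Q₄.exponentℤ-quadratic (v +ℤ 1ℤ)))) ⟩
    + suc (J₄.exponentℤ (- k) + J₄.exponentℤ (v +ℤ 1ℤ)) ∎)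
    where
    open ≡-Reasoning
    identity : ∀ k v →
      (+ 3 *ℤ (k +ℤ - v) *ℤ (k +ℤ - v) +ℤ (+ 1 -ℤ + 3) *ℤ (k +ℤ - v))
        +ℤ (+ 3 *ℤ (+ 2 *ℤ v +ℤ 1ℤ +ℤ (k +ℤ - v)) *ℤ (+ 2 *ℤ v +ℤ 1ℤ +ℤ (k +ℤ - v)) +ℤ (+ 3 -ℤ + 3) *ℤ (+ 2 *ℤ v +ℤ 1ℤ +ℤ (k +ℤ - v)))
      ≡ 1ℤ +ℤ ((+ 6 *ℤ (- k) *ℤ (- k) +ℤ (+ 2 -ℤ + 6) *ℤ (- k)) +ℤ (+ 6 *ℤ (v +ℤ 1ℤ) *ℤ (v +ℤ 1ℤ) +ℤ (+ 2 -ℤ + 6) *ℤ (v +ℤ 1ℤ)))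
    identity = ℤ-Solver.solve-∀

  J₁-sign≡1 : ∀ t → J₁.signℤ t ≡ 1ℤ
  J₁-sign≡1 t = trans (J₁.signℤ≡s^∣∣ t) (ℤₚ.^-zeroˡ ∣ t ∣)

  sign-even : ∀ k v → J₁.signℤ (k +ℤ - v) *ℤ J₂.signℤ (evenℤ v +ℤ (k +ℤ - v)) ≡ J₃.signℤ k *ℤ J₃.signℤ (- v)
  sign-even k v =
    trans (cong₂ _*ℤ_ (J₁-sign≡1 (k +ℤ - v)) (J₂.signℤ≡s^∣∣ (evenℤ v +ℤ (k +ℤ - v))))
    (trans (ℤₚ.*-identityˡ _)
    (trans (cong parity (collapse k v))
    (trans (parity-+ k v) (sym (cong₂ _*ℤ_ (J₃.signℤ≡s^∣∣ k) (trans (J₃.signℤ≡s^∣∣ (- v)) (parity-neg v)))))))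
    where
    collapse : ∀ k v → + 2 *ℤ v +ℤ (k +ℤ - v) ≡ k +ℤ v
    collapse = ℤ-Solver.solve-∀

  sign-odd : ∀ k v → J₁.signℤ (k +ℤ - v) *ℤ J₂.signℤ (oddℤ v +ℤ (k +ℤ - v)) ≡ J₄.signℤ (- k) *ℤ J₄.signℤ (v +ℤ 1ℤ)
  sign-odd k v =
    trans (cong₂ _*ℤ_ (J₁-sign≡1 (k +ℤ - v)) (J₂.signℤ≡s^∣∣ (oddℤ v +ℤ (k +ℤ - v))))
    (trans (ℤₚ.*-identityˡ _)
    (trans (cong parity (collapse k v))
    (trans (parity-+ k (v +ℤ 1ℤ)) (sym (cong₂ _*ℤ_ (trans (J₄.signℤ≡s^∣∣ (- k)) (parity-neg k)) (J₄.signℤ≡s^∣∣ (v +ℤ 1ℤ)))))))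
    where
    collapse : ∀ k v → + 2 *ℤ v +ℤ 1ℤ +ℤ (k +ℤ - v) ≡ k +ℤ (v +ℤ 1ℤ)
    collapse = ℤ-Solver.solve-∀

  θ₁⊛θ₂ : θ₁ ⊛ θ₂ ≈ θ₃ ⊛ θ₃ ⊕ qTimes (θ₄ ⊛ θ₄)
  θ₁⊛θ₂ = Schröter.schröter J₁.exponentℤ J₂.exponentℤ J₃.exponentℤ J₄.exponentℤ J₁.signℤ J₂.signℤ J₃.signℤ J₄.signℤ
            J₁.∣∣≤exponentℤ J₂.∣∣≤exponentℤ J₃.∣∣≤exponentℤ J₄.∣∣≤exponentℤ exponent-even exponent-odd sign-even sign-odd

  poch : ℕ → ℕ → Series
  poch e m = qPoch -1ℤ e m

  poch⁺ : ℕ → ℕ → Series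
  poch⁺ e m = qPoch 1ℤ e m

  poch-6-6≈ : poch 6 6 ≈ poch 6 12 ⊛ poch 12 12
  poch-6-6≈ = ≈-trans (qPoch-split 2 -1ℤ 6 6 ℕₚ.0<1+n ℕₚ.0<1+n ℕₚ.0<1+n) (⊛-cong (⊛-identityˡ (poch 6 12)) (≈-refl {poch 12 12}))

  f₂≈ : f 2 ≈ poch 2 12 ⊛ poch 10 12 ⊛ (poch 4 12 ⊛ poch 8 12) ⊛ poch 6 12 ⊛ poch 12 12
  f₂≈ =
    ≈-trans (f≈qPoch 2)
    (≈-trans (qPoch-split 3 -1ℤ 2 2 ℕₚ.0<1+n ℕₚ.0<1+n ℕₚ.0<1+n)
    (≈-trans (⊛-cong (⊛-cong (⊛-cong (≈-refl {one}) (qPoch-split 2 -1ℤ 2 6 ℕₚ.0<1+n ℕₚ.0<1+n ℕₚ.0<1+n)) (qPoch-split 2 -1ℤ 4 6 ℕₚ.0<1+n ℕₚ.0<1+n ℕₚ.0<1+n)) poch-6-6≈)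
             (solve 6 (λ d x₈ x₄ e h k → con 1ℤ :* (con 1ℤ :* d :* x₈) :* (con 1ℤ :* x₄ :* e) :* (h :* k)
                                         := d :* e :* (x₄ :* x₈) :* h :* k)
                      ≈-refl (poch 2 12) (poch 8 12) (poch 4 12) (poch 10 12) (poch 6 12) (poch 12 12))))

  f₁≈ : f 1 ≈ poch 1 6 ⊛ poch 5 6 ⊛ poch 3 6 ⊛ f 2
  f₁≈ =
    ≈-trans (f≈qPoch 1)
    (≈-trans (qPoch-split 2 -1ℤ 1 1 ℕₚ.0<1+n ℕₚ.0<1+n ℕₚ.0<1+n)
    (≈-trans (⊛-cong (⊛-cong (≈-refl {one}) (qPoch-split 3 -1ℤ 1 2 ℕₚ.0<1+n ℕₚ.0<1+n ℕₚ.0<1+n)) (≈-sym (f≈qPoch 2)))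
             (solve 4 (λ a c b f₂ → con 1ℤ :* (con 1ℤ :* a :* c :* b) :* f₂ := a :* b :* c :* f₂)
                      ≈-refl (poch 1 6) (poch 3 6) (poch 5 6) (f 2))))

  f₃≈ : f 3 ≈ poch 3 6 ⊛ (poch 6 12 ⊛ poch 12 12)
  f₃≈ =
    ≈-trans (f≈qPoch 3)
    (≈-trans (qPoch-split 2 -1ℤ 3 3 ℕₚ.0<1+n ℕₚ.0<1+n ℕₚ.0<1+n) (⊛-cong (⊛-identityˡ (poch 3 6)) poch-6-6≈))

  f₄≈ : f 4 ≈ poch 4 12 ⊛ poch 8 12 ⊛ poch 12 12
  f₄≈ =
    ≈-trans (f≈qPoch 4)
    (≈-trans (qPoch-split 3 -1ℤ 4 4 ℕₚ.0<1+n ℕₚ.0<1+n ℕₚ.0<1+n) (⊛-cong (⊛-cong (⊛-identityˡ (poch 4 12)) (≈-refl {poch 8 12})) (≈-refl {poch 12 12})))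

  f₆≈ : f 6 ≈ poch 6 12 ⊛ poch 12 12
  f₆≈ = ≈-trans (f≈qPoch 6) poch-6-6≈

  θ₁≈ : θ₁ ≈ poch⁺ 1 6 ⊛ poch⁺ 5 6 ⊛ (poch 6 12 ⊛ poch 12 12)
  θ₁≈ = ≈-trans J₁.jacobi-triple-product (⊛-cong (≈-refl {poch⁺ 1 6 ⊛ poch⁺ 5 6}) poch-6-6≈)

  θ₂≈ : θ₂ ≈ poch 3 6 ⊛ poch 3 6 ⊛ (poch 6 12 ⊛ poch 12 12)
  θ₂≈ = ≈-trans J₂.jacobi-triple-product (⊛-cong (≈-refl {poch 3 6 ⊛ poch 3 6}) poch-6-6≈)

  θ₃≈f₄ : θ₃ ≈ f 4
  θ₃≈f₄ = ≈-trans J₃.jacobi-triple-product (≈-sym f₄≈)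

  θ₄≈ : θ₄ ≈ poch 2 12 ⊛ poch 10 12 ⊛ poch 12 12
  θ₄≈ = J₄.jacobi-triple-product

  θ₁-eta : θ₁ ⊛ (f 1 ⊛ f 4 ⊛ f 6) ≈ f 2 ^^ 2 ⊛ f 3 ⊛ f 12
  θ₁-eta = begin
      θ₁ ⊛ (f 1 ⊛ f 4 ⊛ f 6)
    ≈⟨ ⊛-cong θ₁≈ (⊛-cong (⊛-cong f₁≈ f₄≈) f₆≈) ⟩
      n₁ ⊛ n₅ ⊛ (h ⊛ k) ⊛ (a ⊛ b ⊛ c ⊛ f 2 ⊛ (x₄ ⊛ x₈ ⊛ k) ⊛ (h ⊛ k))
    ≈⟨ solve 10 (λ n₁ n₅ h k a b c F x₄ x₈ → n₁ :* n₅ :* (h :* k) :* (a :* b :* c :* F :* (x₄ :* x₈ :* k) :* (h :* k))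
                  := (n₁ :* a) :* (n₅ :* b) :* (x₄ :* x₈) :* h :* k :* F :* (c :* (h :* k)) :* k)
                ≈-refl n₁ n₅ h k a b c (f 2) x₄ x₈ ⟩
      (n₁ ⊛ a) ⊛ (n₅ ⊛ b) ⊛ (x₄ ⊛ x₈) ⊛ h ⊛ k ⊛ f 2 ⊛ (c ⊛ (h ⊛ k)) ⊛ k
    ≈⟨ ⊛-cong (⊛-cong (⊛-cong (⊛-cong (⊛-cong (⊛-cong (⊛-cong (qPoch-plus-minus 1 6 ℕₚ.0<1+n ℕₚ.0<1+n) (qPoch-plus-minus 5 6 ℕₚ.0<1+n ℕₚ.0<1+n))
         (≈-refl {x₄ ⊛ x₈})) (≈-refl {h})) (≈-refl {k})) (≈-refl {f 2})) (≈-sym f₃≈)) (≈-sym (f≈qPoch 12)) ⟩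
      poch 2 12 ⊛ poch 10 12 ⊛ (x₄ ⊛ x₈) ⊛ h ⊛ k ⊛ f 2 ⊛ f 3 ⊛ f 12
    ≈⟨ ⊛-cong (⊛-cong (⊛-cong (≈-sym f₂≈) (≈-refl {f 2})) (≈-refl {f 3})) (≈-refl {f 12}) ⟩
      f 2 ⊛ f 2 ⊛ f 3 ⊛ f 12
    ≈⟨ solve 3 (λ x y z → x :* x :* y :* z := x :^ 2 :* y :* z) ≈-refl (f 2) (f 3) (f 12) ⟩
      f 2 ^^ 2 ⊛ f 3 ⊛ f 12 ∎
    where
    open ≈-Reasoning
    n₁ n₅ a b c x₄ x₈ h k : Series
    n₁ = poch⁺ 1 6
    n₅ = poch⁺ 5 6
    a = poch 1 6
    b = poch 5 6
    c = poch 3 6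
    x₄ = poch 4 12
    x₈ = poch 8 12
    h = poch 6 12
    k = poch 12 12

  θ₂-eta : θ₂ ⊛ f 6 ≈ f 3 ^^ 2
  θ₂-eta =
    ≈-trans (⊛-cong θ₂≈ f₆≈)
    (≈-trans (solve 2 (λ c H → c :* c :* H :* H := (c :* H) :^ 2) ≈-refl (poch 3 6) (poch 6 12 ⊛ poch 12 12))
             (≈-sym (^^-cong 2 f₃≈)))

  θ₄-eta : θ₄ ⊛ (f 4 ⊛ f 6) ≈ f 2 ⊛ f 12 ^^ 2
  θ₄-eta =
    ≈-trans (⊛-cong θ₄≈ (⊛-cong f₄≈ f₆≈))
    (≈-trans (solve 6 (λ d e x₄ x₈ h k → d :* e :* k :* (x₄ :* x₈ :* k :* (h :* k)) := (d :* e :* (x₄ :* x₈) :* h :* k) :* k :^ 2)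
                      ≈-refl (poch 2 12) (poch 10 12) (poch 4 12) (poch 8 12) (poch 6 12) (poch 12 12))
             (≈-sym (⊛-cong f₂≈ (^^-cong 2 (f≈qPoch 12)))))

open ThetaIdentities

module EtaQuotients where

  open Series-Solver using (solve; _:=_; _:+_; _:*_; _:^_; con)

  schröter-eta : f 3 ^^ 3 ⊛ f 2 ^^ 2 ⊛ f 12 ⊛ f 4 ≈ f 1 ⊛ f 4 ^^ 4 ⊛ f 6 ^^ 2 ⊕ q ⊛ (f 1 ⊛ f 2 ^^ 2 ⊛ f 12 ^^ 4)
  schröter-eta = ≈-trans f-side (≈-trans (⊛-cong θ₁⊛θ₂ (≈-refl {M})) θ-side)
    where
    open ≈-Reasoning
    M : Series
    M = (f 1 ⊛ f 4 ⊛ f 6) ⊛ (f 6 ⊛ f 4)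
    f-side : f 3 ^^ 3 ⊛ f 2 ^^ 2 ⊛ f 12 ⊛ f 4 ≈ (θ₁ ⊛ θ₂) ⊛ M
    f-side = ≈-sym (begin
        (θ₁ ⊛ θ₂) ⊛ M
      ≈⟨ solve 5 (λ t1 t2 f1 f4 f6 → (t1 :* t2) :* ((f1 :* f4 :* f6) :* (f6 :* f4)) := (t1 :* (f1 :* f4 :* f6)) :* (t2 :* f6) :* f4) ≈-refl θ₁ θ₂ (f 1) (f 4) (f 6) ⟩
        (θ₁ ⊛ (f 1 ⊛ f 4 ⊛ f 6)) ⊛ (θ₂ ⊛ f 6) ⊛ f 4
      ≈⟨ ⊛-cong (⊛-cong θ₁-eta θ₂-eta) (≈-refl {f 4}) ⟩
        (f 2 ^^ 2 ⊛ f 3 ⊛ f 12) ⊛ f 3 ^^ 2 ⊛ f 4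
      ≈⟨ solve 4 (λ f2 f3 f4 f12 → (f2 :^ 2 :* f3 :* f12) :* f3 :^ 2 :* f4 := f3 :^ 3 :* f2 :^ 2 :* f12 :* f4) ≈-refl (f 2) (f 3) (f 4) (f 12) ⟩
        f 3 ^^ 3 ⊛ f 2 ^^ 2 ⊛ f 12 ⊛ f 4 ∎)
    θ-side : (θ₃ ⊛ θ₃ ⊕ qTimes (θ₄ ⊛ θ₄)) ⊛ M ≈ f 1 ⊛ f 4 ^^ 4 ⊛ f 6 ^^ 2 ⊕ q ⊛ (f 1 ⊛ f 2 ^^ 2 ⊛ f 12 ^^ 4)
    θ-side = begin
        (θ₃ ⊛ θ₃ ⊕ qTimes (θ₄ ⊛ θ₄)) ⊛ M
      ≈⟨ ⊛-cong (⊕-cong (⊛-cong θ₃≈f₄ θ₃≈f₄) (qTimes≈q⊛ (θ₄ ⊛ θ₄))) (≈-refl {M}) ⟩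
        (f 4 ⊛ f 4 ⊕ q ⊛ (θ₄ ⊛ θ₄)) ⊛ M
      ≈⟨ solve 5 (λ f1 f4 f6 t4 x → (f4 :* f4 :+ x :* (t4 :* t4)) :* ((f1 :* f4 :* f6) :* (f6 :* f4))
                 := (f4 :* f4) :* ((f1 :* f4 :* f6) :* (f6 :* f4)) :+ x :* ((t4 :* (f4 :* f6)) :* (t4 :* (f4 :* f6)) :* f1)) ≈-refl (f 1) (f 4) (f 6) θ₄ q ⟩
        (f 4 ⊛ f 4) ⊛ M ⊕ q ⊛ ((θ₄ ⊛ (f 4 ⊛ f 6)) ⊛ (θ₄ ⊛ (f 4 ⊛ f 6)) ⊛ f 1)
      ≈⟨ ⊕-cong (≈-refl {(f 4 ⊛ f 4) ⊛ M}) (⊛-cong (≈-refl {q}) (⊛-cong (⊛-cong θ₄-eta θ₄-eta) (≈-refl {f 1}))) ⟩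
        (f 4 ⊛ f 4) ⊛ M ⊕ q ⊛ ((f 2 ⊛ f 12 ^^ 2) ⊛ (f 2 ⊛ f 12 ^^ 2) ⊛ f 1)
      ≈⟨ solve 6 (λ f1 f2 f4 f6 f12 x → (f4 :* f4) :* ((f1 :* f4 :* f6) :* (f6 :* f4)) :+ x :* ((f2 :* f12 :^ 2) :* (f2 :* f12 :^ 2) :* f1)
                 := f1 :* f4 :^ 4 :* f6 :^ 2 :+ x :* (f1 :* f2 :^ 2 :* f12 :^ 4)) ≈-refl (f 1) (f 2) (f 4) (f 6) (f 12) q ⟩
        f 1 ⊛ f 4 ^^ 4 ⊛ f 6 ^^ 2 ⊕ q ⊛ (f 1 ⊛ f 2 ^^ 2 ⊛ f 12 ^^ 4) ∎

  f⁻¹ : ℕ → Series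
  f⁻¹ m = inv (f m)

  f⊛f⁻¹ : ∀ m → f m ⊛ f⁻¹ m ≈ one
  f⊛f⁻¹ m = ⊛-inverseʳ (f m) refl

  A B : Series
  A = f 4 ^^ 3 ⊛ f 6 ^^ 2 ⊛ f⁻¹ 2 ^^ 2 ⊛ f⁻¹ 12
  B = f 12 ^^ 3 ⊛ f⁻¹ 4

  f₃³/f₁-dissection : f 3 ^^ 3 ⊛ f⁻¹ 1 ≈ A ⊕ q ⊛ B
  f₃³/f₁-dissection = begin
      f 3 ^^ 3 ⊛ f⁻¹ 1
    ≈⟨ ≈-sym L⊛I≈f₃³⊛f₁⁻¹ ⟩
      L ⊛ I
    ≈⟨ ⊛-cong schröter-eta (≈-refl {I}) ⟩
      (P ⊕ q ⊛ Q) ⊛ I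
    ≈⟨ solve 4 (λ p q i x → (p :+ x :* q) :* i := p :* i :+ x :* (q :* i)) ≈-refl P Q I q ⟩
      P ⊛ I ⊕ q ⊛ (Q ⊛ I)
    ≈⟨ ⊕-cong P⊛I≈A (⊛-cong (≈-refl {q}) Q⊛I≈B) ⟩
      A ⊕ q ⊛ B ∎
    where
    open ≈-Reasoning
    L I P Q : Series
    L = f 3 ^^ 3 ⊛ f 2 ^^ 2 ⊛ f 12 ⊛ f 4
    I = f⁻¹ 1 ⊛ f⁻¹ 2 ^^ 2 ⊛ f⁻¹ 12 ⊛ f⁻¹ 4
    P = f 1 ⊛ f 4 ^^ 4 ⊛ f 6 ^^ 2
    Q = f 1 ⊛ f 2 ^^ 2 ⊛ f 12 ^^ 4
    L⊛I≈f₃³⊛f₁⁻¹ : L ⊛ I ≈ f 3 ^^ 3 ⊛ f⁻¹ 1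
    L⊛I≈f₃³⊛f₁⁻¹ = begin
        L ⊛ I
      ≈⟨ solve 8 (λ f3 w1 f2 w2 f12 w12 f4 w4 → (f3 :^ 3 :* f2 :^ 2 :* f12 :* f4) :* (w1 :* w2 :^ 2 :* w12 :* w4)
                   := (f3 :^ 3 :* w1) :* ((f2 :* w2) :* (f2 :* w2) :* (f12 :* w12) :* (f4 :* w4))) ≈-refl (f 3) (f⁻¹ 1) (f 2) (f⁻¹ 2) (f 12) (f⁻¹ 12) (f 4) (f⁻¹ 4) ⟩
        (f 3 ^^ 3 ⊛ f⁻¹ 1) ⊛ ((f 2 ⊛ f⁻¹ 2) ⊛ (f 2 ⊛ f⁻¹ 2) ⊛ (f 12 ⊛ f⁻¹ 12) ⊛ (f 4 ⊛ f⁻¹ 4))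
      ≈⟨ ⊛-cong (≈-refl {f 3 ^^ 3 ⊛ f⁻¹ 1}) (⊛-cong (⊛-cong (⊛-cong (f⊛f⁻¹ 2) (f⊛f⁻¹ 2)) (f⊛f⁻¹ 12)) (f⊛f⁻¹ 4)) ⟩
        (f 3 ^^ 3 ⊛ f⁻¹ 1) ⊛ (one ⊛ one ⊛ one ⊛ one)
      ≈⟨ solve 1 (λ y → y :* (con 1ℤ :* con 1ℤ :* con 1ℤ :* con 1ℤ) := y) ≈-refl (f 3 ^^ 3 ⊛ f⁻¹ 1) ⟩
        f 3 ^^ 3 ⊛ f⁻¹ 1 ∎
    P⊛I≈A : P ⊛ I ≈ A
    P⊛I≈A = begin
        P ⊛ I
      ≈⟨ solve 7 (λ f1 f4 f6 w1 w2 w12 w4 → (f1 :* f4 :^ 4 :* f6 :^ 2) :* (w1 :* w2 :^ 2 :* w12 :* w4)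
                   := (f1 :* w1) :* (f4 :* w4) :* (f4 :^ 3 :* f6 :^ 2 :* w2 :^ 2 :* w12)) ≈-refl (f 1) (f 4) (f 6) (f⁻¹ 1) (f⁻¹ 2) (f⁻¹ 12) (f⁻¹ 4) ⟩
        (f 1 ⊛ f⁻¹ 1) ⊛ (f 4 ⊛ f⁻¹ 4) ⊛ A
      ≈⟨ ⊛-cong (⊛-cong (f⊛f⁻¹ 1) (f⊛f⁻¹ 4)) (≈-refl {A}) ⟩
        one ⊛ one ⊛ A
      ≈⟨ solve 1 (λ y → con 1ℤ :* con 1ℤ :* y := y) ≈-refl A ⟩
        A ∎
    Q⊛I≈B : Q ⊛ I ≈ B
    Q⊛I≈B = begin
        Q ⊛ I
      ≈⟨ solve 7 (λ f1 f2 f12 w1 w2 w12 w4 → (f1 :* f2 :^ 2 :* f12 :^ 4) :* (w1 :* w2 :^ 2 :* w12 :* w4)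
                   := (f1 :* w1) :* (f2 :* w2) :* (f2 :* w2) :* (f12 :* w12) :* (f12 :^ 3 :* w4)) ≈-refl (f 1) (f 2) (f 12) (f⁻¹ 1) (f⁻¹ 2) (f⁻¹ 12) (f⁻¹ 4) ⟩
        (f 1 ⊛ f⁻¹ 1) ⊛ (f 2 ⊛ f⁻¹ 2) ⊛ (f 2 ⊛ f⁻¹ 2) ⊛ (f 12 ⊛ f⁻¹ 12) ⊛ B
      ≈⟨ ⊛-cong (⊛-cong (⊛-cong (⊛-cong (f⊛f⁻¹ 1) (f⊛f⁻¹ 2)) (f⊛f⁻¹ 2)) (f⊛f⁻¹ 12)) (≈-refl {B}) ⟩
        one ⊛ one ⊛ one ⊛ one ⊛ B
      ≈⟨ solve 1 (λ y → con 1ℤ :* con 1ℤ :* con 1ℤ :* con 1ℤ :* y := y) ≈-refl B ⟩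
        B ∎

  inv-cong : ∀ {a b} → a ≈ b → a 0 ≡ 1ℤ → b 0 ≡ 1ℤ → inv a ≈ inv b
  inv-cong {a} {b} a≈b a₀≡1 b₀≡1 =
    inverse-unique a (inv a) (inv b) (⊛-inverseʳ a a₀≡1) (≈-trans (⊛-cong a≈b (≈-refl {inv b})) (⊛-inverseʳ b b₀≡1))

  dilate-f : ∀ m → 1 ≤ m → dilate (f m) ≈ f (twice m)
  dilate-f m 1≤m = ≈-trans (dilate-cong (f≈qPoch m)) (≈-trans (dilate-qPoch -1ℤ m m 1≤m 1≤m) (≈-sym (f≈qPoch (twice m))))

  dilate-f⁻¹ : ∀ m → 1 ≤ m → dilate (f⁻¹ m) ≈ f⁻¹ (twice m)
  dilate-f⁻¹ m 1≤m = ≈-trans (dilate-inv (f m) refl) (inv-cong (dilate-f m 1≤m) refl refl)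

  dilate-eta-quotient : ∀ a b c d i j k l →
    dilate (a ^^ i ⊛ b ^^ j ⊛ c ^^ k ⊛ d ^^ l) ≈ dilate a ^^ i ⊛ dilate b ^^ j ⊛ dilate c ^^ k ⊛ dilate d ^^ l
  dilate-eta-quotient a b c d i j k l =
    ≈-trans (dilate-⊛ _ _)
    (⊛-cong (≈-trans (dilate-⊛ _ _) (⊛-cong (≈-trans (dilate-⊛ _ _) (⊛-cong (dilate-^^ a i) (dilate-^^ b j))) (dilate-^^ c k)))
            (dilate-^^ d l))

  evenGF₀ evenGF₁ oddGF₀ : Series
  evenGF₀ = f 2 ^^ 6 ⊛ f 3 ^^ 10 ⊛ f⁻¹ 1 ^^ 6 ⊛ f⁻¹ 6 ^^ 2
  evenGF₁ = f 3 ^^ 6 ⊛ f 6 ^^ 6 ⊛ f⁻¹ 1 ^^ 2 ⊛ f⁻¹ 2 ^^ 2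
  oddGF₀  = f 2 ^^ 2 ⊛ f 3 ^^ 8 ⊛ f 6 ^^ 2 ⊛ f⁻¹ 1 ^^ 4

  Y : Series
  Y = f 6 ^^ 6 ⊛ f⁻¹ 2 ^^ 2

  A⊛A⊛Y : A ⊛ A ⊛ Y ≈ dilate evenGF₀
  A⊛A⊛Y = begin
      A ⊛ A ⊛ (f 6 ^^ 6 ⊛ f⁻¹ 2 ^^ 2)
    ≈⟨ ⊛-cong (≈-refl {A ⊛ A}) (⊛-cong (^^-* (f 6) 2 3) (≈-refl {f⁻¹ 2 ^^ 2})) ⟩
      A ⊛ A ⊛ (r ^^ 3 ⊛ t)
    ≈⟨ solve 4 (λ p r t u → (p :* r :* t :* u) :* (p :* r :* t :* u) :* (r :^ 3 :* t) := p :^ 2 :* r :^ 5 :* t :^ 3 :* u :^ 2) ≈-refl p r t u ⟩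
      p ^^ 2 ⊛ r ^^ 5 ⊛ t ^^ 3 ⊛ u ^^ 2
    ≈⟨ ≈-sym (⊛-cong (⊛-cong (⊛-cong (^^-* (f 4) 3 2) (^^-* (f 6) 2 5)) (^^-* (f⁻¹ 2) 2 3)) (≈-refl {u ^^ 2})) ⟩
      f 4 ^^ 6 ⊛ f 6 ^^ 10 ⊛ f⁻¹ 2 ^^ 6 ⊛ f⁻¹ 12 ^^ 2
    ≈⟨ ≈-sym (≈-trans (dilate-eta-quotient (f 2) (f 3) (f⁻¹ 1) (f⁻¹ 6) 6 10 6 2)
         (⊛-cong (⊛-cong (⊛-cong (^^-cong 6 (dilate-f 2 ℕₚ.0<1+n)) (^^-cong 10 (dilate-f 3 ℕₚ.0<1+n))) (^^-cong 6 (dilate-f⁻¹ 1 ℕₚ.0<1+n)))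
                 (^^-cong 2 (dilate-f⁻¹ 6 ℕₚ.0<1+n)))) ⟩
      dilate evenGF₀ ∎
    where
    open ≈-Reasoning
    p r t u : Series
    p = f 4 ^^ 3
    r = f 6 ^^ 2
    t = f⁻¹ 2 ^^ 2
    u = f⁻¹ 12

  B⊛B⊛Y : B ⊛ B ⊛ Y ≈ dilate evenGF₁
  B⊛B⊛Y = begin
      B ⊛ B ⊛ Y
    ≈⟨ solve 4 (λ f₆ f₁₂ w₂ w₄ → (f₁₂ :^ 3 :* w₄) :* (f₁₂ :^ 3 :* w₄) :* (f₆ :^ 6 :* w₂ :^ 2)
                := f₆ :^ 6 :* f₁₂ :^ 6 :* w₂ :^ 2 :* w₄ :^ 2) ≈-refl (f 6) (f 12) (f⁻¹ 2) (f⁻¹ 4) ⟩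
      f 6 ^^ 6 ⊛ f 12 ^^ 6 ⊛ f⁻¹ 2 ^^ 2 ⊛ f⁻¹ 4 ^^ 2
    ≈⟨ ≈-sym (≈-trans (dilate-eta-quotient (f 3) (f 6) (f⁻¹ 1) (f⁻¹ 2) 6 6 2 2)
         (⊛-cong (⊛-cong (⊛-cong (^^-cong 6 (dilate-f 3 ℕₚ.0<1+n)) (^^-cong 6 (dilate-f 6 ℕₚ.0<1+n))) (^^-cong 2 (dilate-f⁻¹ 1 ℕₚ.0<1+n)))
                 (^^-cong 2 (dilate-f⁻¹ 2 ℕₚ.0<1+n)))) ⟩
      dilate evenGF₁ ∎
    where open ≈-Reasoning

  A⊛B⊛Y : A ⊛ B ⊛ Y ≈ dilate oddGF₀
  A⊛B⊛Y = begin
      A ⊛ B ⊛ (f 6 ^^ 6 ⊛ f⁻¹ 2 ^^ 2)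
    ≈⟨ ⊛-cong (≈-refl {A ⊛ B}) (⊛-cong (^^-* (f 6) 2 3) (≈-refl {f⁻¹ 2 ^^ 2})) ⟩
      A ⊛ B ⊛ (r ^^ 3 ⊛ t)
    ≈⟨ solve 6 (λ f₄ r f₁₂ t w₄ w₁₂ → (f₄ :^ 3 :* r :* t :* w₁₂) :* (f₁₂ :^ 3 :* w₄) :* (r :^ 3 :* t)
                := (f₄ :* w₄) :* (f₁₂ :* w₁₂) :* (f₄ :^ 2 :* r :^ 4 :* f₁₂ :^ 2 :* t :^ 2)) ≈-refl (f 4) r (f 12) t (f⁻¹ 4) (f⁻¹ 12) ⟩
      (f 4 ⊛ f⁻¹ 4) ⊛ (f 12 ⊛ f⁻¹ 12) ⊛ (f 4 ^^ 2 ⊛ r ^^ 4 ⊛ f 12 ^^ 2 ⊛ t ^^ 2)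
    ≈⟨ ⊛-cong (⊛-cong (f⊛f⁻¹ 4) (f⊛f⁻¹ 12))
              (⊛-cong (⊛-cong (⊛-cong (≈-refl {f 4 ^^ 2}) (≈-sym (^^-* (f 6) 2 4))) (≈-refl {f 12 ^^ 2})) (≈-sym (^^-* (f⁻¹ 2) 2 2))) ⟩
      one ⊛ one ⊛ (f 4 ^^ 2 ⊛ f 6 ^^ 8 ⊛ f 12 ^^ 2 ⊛ f⁻¹ 2 ^^ 4)
    ≈⟨ solve 1 (λ x → con 1ℤ :* con 1ℤ :* x := x) ≈-refl (f 4 ^^ 2 ⊛ f 6 ^^ 8 ⊛ f 12 ^^ 2 ⊛ f⁻¹ 2 ^^ 4) ⟩
      f 4 ^^ 2 ⊛ f 6 ^^ 8 ⊛ f 12 ^^ 2 ⊛ f⁻¹ 2 ^^ 4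
    ≈⟨ ≈-sym (≈-trans (dilate-eta-quotient (f 2) (f 3) (f 6) (f⁻¹ 1) 2 8 2 4)
         (⊛-cong (⊛-cong (⊛-cong (^^-cong 2 (dilate-f 2 ℕₚ.0<1+n)) (^^-cong 8 (dilate-f 3 ℕₚ.0<1+n))) (^^-cong 2 (dilate-f 6 ℕₚ.0<1+n)))
                 (^^-cong 4 (dilate-f⁻¹ 1 ℕₚ.0<1+n)))) ⟩
      dilate oddGF₀ ∎
    where
    open ≈-Reasoning
    r t : Series
    r = f 6 ^^ 2
    t = f⁻¹ 2 ^^ 2

  CP3series-dissection : CP3series ≈ dilate (evenGF₀ ⊕ qTimes evenGF₁) ⊕ qTimes (dilate (scale (+ 2) oddGF₀))
  CP3series-dissection = begin
      CP3series
    ≈⟨ ⊛-cong (⊛-cong (⊛-cong (^^-* (f 3) 3 2) (≈-refl {f 6 ^^ 6})) (≈-refl {f⁻¹ 1 ^^ 2})) (≈-refl {f⁻¹ 2 ^^ 2}) ⟩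
      (f 3 ^^ 3) ^^ 2 ⊛ f 6 ^^ 6 ⊛ f⁻¹ 1 ^^ 2 ⊛ f⁻¹ 2 ^^ 2
    ≈⟨ solve 4 (λ c F w₁ t → c :^ 2 :* F :* w₁ :^ 2 :* t := (c :* w₁) :* (c :* w₁) :* (F :* t)) ≈-refl (f 3 ^^ 3) (f 6 ^^ 6) (f⁻¹ 1) (f⁻¹ 2 ^^ 2) ⟩
      (f 3 ^^ 3 ⊛ f⁻¹ 1) ⊛ (f 3 ^^ 3 ⊛ f⁻¹ 1) ⊛ Y
    ≈⟨ ⊛-cong (⊛-cong f₃³/f₁-dissection f₃³/f₁-dissection) (≈-refl {Y}) ⟩
      (A ⊕ q ⊛ B) ⊛ (A ⊕ q ⊛ B) ⊛ Y
    ≈⟨ solve 4 (λ a b x y → (a :+ x :* b) :* (a :+ x :* b) :* y := a :* a :* y :+ x :* (x :* (b :* b :* y)) :+ x :* (con (+ 2) :* (a :* b :* y)))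
               ≈-refl A B q Y ⟩
      A ⊛ A ⊛ Y ⊕ q ⊛ (q ⊛ (B ⊛ B ⊛ Y)) ⊕ q ⊛ (const (+ 2) ⊛ (A ⊛ B ⊛ Y))
    ≈⟨ ⊕-cong (⊕-cong A⊛A⊛Y (⊛-cong (≈-refl {q}) (⊛-cong (≈-refl {q}) B⊛B⊛Y))) (⊛-cong (≈-refl {q}) (⊛-cong (≈-refl {const (+ 2)}) A⊛B⊛Y)) ⟩
      dilate evenGF₀ ⊕ q ⊛ (q ⊛ dilate evenGF₁) ⊕ q ⊛ (const (+ 2) ⊛ dilate oddGF₀)
    ≈⟨ ≈-sym (⊕-cong (≈-trans (dilate-⊕ evenGF₀ (qTimes evenGF₁)) (⊕-cong (≈-refl {dilate evenGF₀}) dilate-q-part))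
                      (≈-trans (qTimes≈q⊛ _) (⊛-cong (≈-refl {q}) (≈-trans (dilate-scale (+ 2) oddGF₀) (≈-sym (const-⊛ (+ 2) (dilate oddGF₀))))))) ⟩
      dilate (evenGF₀ ⊕ qTimes evenGF₁) ⊕ qTimes (dilate (scale (+ 2) oddGF₀)) ∎
    where
    open ≈-Reasoning
    dilate-q-part : dilate (qTimes evenGF₁) ≈ q ⊛ (q ⊛ dilate evenGF₁)
    dilate-q-part = ≈-trans (dilate-qTimes evenGF₁) (≈-trans (qTimes≈q⊛ _) (⊛-cong (≈-refl {q}) (qTimes≈q⊛ _)))

open EtaQuotients

theorem3p1 : ((n : ℕ) → CP3 (2 * n)
               ≡ (f 2 ^^ 6 ⊛ f 3 ^^ 10 ⊛ inv (f 1) ^^ 6 ⊛ inv (f 6) ^^ 2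
                  ⊕ qTimes (f 3 ^^ 6 ⊛ f 6 ^^ 6 ⊛ inv (f 1) ^^ 2 ⊛ inv (f 2) ^^ 2)) n)
           × ((n : ℕ) → CP3 (2 * n + 1)
               ≡ scale (+ 2) (f 2 ^^ 2 ⊛ f 3 ^^ 8 ⊛ f 6 ^^ 2 ⊛ inv (f 1) ^^ 4) n)
theorem3p1 = coefficients-of-dissection CP3series-dissection
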